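{- Let $i \in \mathbb{Z}_{\geq 1}$ and let $B$ be a subset of $[n]$. Then $\mathrm{Cons}(V_B, i) = \mathrm{Gov}(V_B, i)$.
   Context: $[n] = \{1,\dots,n\}$; $V_{[n]} = \mathbb{F}_2^{[n]}$ with standard basis $(e_h)$ and dual functionals $\chi_h$. For functionals $\lambda_1,\dots,\lambda_i$, $\lambda_1\otimes\dots\otimes\lambda_i$ denotes $(\sigma_1,\dots,\sigma_i)\mapsto\prod_h\lambda_h(\sigma_h)$ on $V_{[n]}^i$. For $B \subseteq [n]$, $\widetilde{\mathrm{Multi}}(V_B, i)$ is the span of $\chi_{\tau(1)} \otimes \dots \otimes \chi_{\tau(i)}$ over injective maps $\tau: [i] \to B$. For $b \in \widetilde{\mathrm{Multi}}(V_B, i)$ and $j \in B$, $b(e_j, -)$ lies in $\widetilde{\mathrm{Multi}}(V_{B\setminus\{j\}}, i-1)$. Governing tensors: for $A$ with $\#A = i \geq 2$ and $x \in A$, $\phi_{(A,x)} = \sum_\tau \chi_{\tau(1)}\otimes\dots\otimes\chi_{\tau(i)}$ over bijections $\tau:[i]\to A$ with $\tau(i-1)=x$ or $\tau(i)=x$; $\phi_{(\{x\},x)} = \chi_x$. $\mathrm{Gov}(V_B, i)$ is the span of $\phi_{(A,x)}$ with $A \subseteq B$, $\#A = i$, $x \in A$. Consistent tensors $\mathrm{Cons}(V_B,i) \subseteq \widetilde{\mathrm{Multi}}(V_B,i)$, defined recursively for all $B\subseteq[n]$: $\mathrm{Cons}(V_B,1) = \mathrm{Gov}(V_B,1)$;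 $\mathrm{Cons}(V_B,2)$ is the set of $b$ with $b(\sigma_1,\sigma_2) = b(\sigma_2,\sigma_1)$ for all $\sigma_1,\sigma_2$; $\mathrm{Cons}(V_B,3)$ is the set of $b$ such that $b(e_j,-,-) \in \mathrm{Cons}(V_{B\setminus\{j\}},2)$ for every $j \in B$ and $b(\sigma_1,\sigma_2,\sigma_3)+b(\sigma_3,\sigma_1,\sigma_2)+b(\sigma_2,\sigma_3,\sigma_1) = 0$ for all $\sigma_1,\sigma_2,\sigma_3 \in \{e_j\}_{j\in[n]}$; for $i \geq 4$, $\mathrm{Cons}(V_B,i)$ is the set of $b$ such that $b(e_j,-) \in \mathrm{Cons}(V_{B\setminus\{j\}},i-1)$ for every $j \in B$ and $b(e_{j_1},e_{j_2},-) = b(e_{j_2},e_{j_1},-)$ for all distinct $j_1,j_2 \in B$. -}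

module Defs where

open import Data.Nat using (ℕ; zero; suc)
open import Data.Bool using (Bool; true; false; _∧_; _∨_; _xor_; not; if_then_else_)
open import Data.Fin using (Fin; zero; suc; fromℕ; inject₁; _≟_)
open import Data.Fin.Subset using (Subset; _∈_; _⊆_; _-_; ∣_∣)
open import Data.Vec using (lookup)
open import Data.Vec.Functional using (Vector; []; _∷_)
open import Data.List using (List; foldr)
open import Data.List.Relation.Unary.All using (All)
open import Data.Product using (Σ; _×_; _,_; proj₁; proj₂)
open import Data.Empty using (⊥)
open import Relation.Nullary using (does; ¬_)
open import Relation.Binary.PropositionalEquality using (_≡_)

-- Field F₂ = Bool with  + = xor,  · = ∧.

_==_ : ∀ {n} → Fin n → Fin n → Bool
x == y = does (x ≟ y)

sumFin : ∀ k → (Fin k → Bool) → Bool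
sumFin zero    f = false
sumFin (suc k) f = f zero xor sumFin k (λ h → f (suc h))

prodFin : ∀ k → (Fin k → Bool) → Bool
prodFin zero    f = true
prodFin (suc k) f = f zero ∧ prodFin k (λ h → f (suc h))

anyFin : ∀ k → (Fin k → Bool) → Bool
anyFin zero    f = false
anyFin (suc k) f = f zero ∨ anyFin k (λ h → f (suc h))

sumMaps : ∀ n i → ((Fin i → Fin n) → Bool) → Bool
sumMaps n zero    F = F (λ ())
sumMaps n (suc i) F = sumFin n (λ j → sumMaps n i (λ τ → F (j ∷ τ)))

-- V_[n] = F₂^[n]; a vector is its coordinate function.
V : ℕ → Set
V n = Fin n → Bool

e : ∀ {n} → Fin n → V n
e h k = h == k

-- A multilinear form on V_[n]^i is determined by (and identified with)
-- its values on tuples of basis vectors:  b τ = b(e_{τ 1}, …, e_{τ i}).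
Tensor : ℕ → ℕ → Set
Tensor n i = (Fin i → Fin n) → Bool

-- evaluation of the multilinear form b at (σ_1, …, σ_i) by multilinear
-- expansion: b(σ) = Σ_τ b(e_τ1,…,e_τi) · Π_h σ_h(τ h)
eval : ∀ {n i} → Tensor n i → (Fin i → V n) → Bool
eval {n} {i} b σ = sumMaps n i (λ τ → b τ ∧ prodFin i (λ h → σ h (τ h)))

_≈_ : ∀ {n i} → Tensor n i → Tensor n i → Set
_≈_ {n} {i} b b' = ∀ (τ : Fin i → Fin n) → b τ ≡ b' τ

zeroT : ∀ {n i} → Tensor n i
zeroT τ = false

_⊕_ : ∀ {n i} → Tensor n i → Tensor n i → Tensor n i
(b ⊕ b') τ = b τ xor b' τ

χ : ∀ {n} → Fin n → (Fin n → Bool)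
χ h j = h == j

⊗ : ∀ {n i} → (Fin i → (Fin n → Bool)) → Tensor n i
⊗ {n} {i} λs ρ = prodFin i (λ h → λs h (ρ h))

χ⊗ : ∀ {n i} → (Fin i → Fin n) → Tensor n i
χ⊗ τ = ⊗ (λ h → χ (τ h))

_·e_ : ∀ {n i} → Tensor n (suc i) → Fin n → Tensor n i
(b ·e j) τ = b (j ∷ τ)

infixl 8 _·e_

-- Spans over F₂: b lies in the span of the family gen indexed by the
-- elements of I satisfying P iff b is a finite sum of such generators.
sumList : ∀ {n i} {I : Set} → (I → Tensor n i) → List I → Tensor n i
sumList gen = foldr (λ a acc → gen a ⊕ acc) zeroT

InSpan : ∀ {n i} (I : Set) → (I → Set) → (I → Tensor n i) → Tensor n i → Set
InSpan I P gen b = Σ (List I) (λ as → All P as × (b ≈ sumList gen as))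

Injective : ∀ {n i} → (Fin i → Fin n) → Set
Injective τ = ∀ h h' → τ h ≡ τ h' → h ≡ h'

InjInto : ∀ {n i} → Subset n → (Fin i → Fin n) → Set
InjInto B τ = Injective τ × (∀ h → τ h ∈ B)

MultiT : ∀ {n} (i : ℕ) → Subset n → Tensor n i → Set
MultiT {n} i B = InSpan (Fin i → Fin n) (InjInto B) χ⊗

injB : ∀ {n i} → (Fin i → Fin n) → Bool
injB {n} {i} τ = prodFin i (λ h → prodFin i (λ h' → (h == h') ∨ not (τ h == τ h')))

isBijOnto : ∀ {n i} → Subset n → (Fin i → Fin n) → Bool
isBijOnto {n} {i} A τ =
  injB τ ∧ prodFin i (λ h → lookup A (τ h))
         ∧ prodFin n (λ a → not (lookup A a) ∨ anyFin i (λ h → τ h == a))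

φ : ∀ {n} (i : ℕ) → Subset n → Fin n → Tensor n i
φ zero             A x = zeroT   -- not used (order 0 does not occur)
φ (suc zero)       A x = ⊗ (λ _ → χ x)                  -- φ_({x},x) = χ_x
φ {n} (suc (suc k)) A x ρ =
  sumMaps n (suc (suc k)) (λ τ →
    (isBijOnto A τ ∧ ((τ (inject₁ (fromℕ k)) == x) ∨ (τ (fromℕ (suc k)) == x)))
    ∧ χ⊗ τ ρ)

GovIx : ℕ → Set
GovIx n = Subset n × Fin n

GovOK : ∀ {n} → ℕ → Subset n → GovIx n → Set
GovOK i B (A , x) = (A ⊆ B) × (∣ A ∣ ≡ i) × (x ∈ A)

Gov : ∀ {n} (i : ℕ) → Subset n → Tensor n i → Set
Gov {n} i B = InSpan (GovIx n) (GovOK i B) (λ p → φ i (proj₁ p) (proj₂ p))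

-- Consistent tensors (defined for i ≥ 1; the value at 0 is unused).
Cons : ∀ {n} (i : ℕ) → Subset n → Tensor n i → Set
Cons zero B b = ⊥
Cons (suc zero) B b = Gov 1 B b
Cons (suc (suc zero)) B b =
  MultiT 2 B b ×
  (∀ σ₁ σ₂ → eval b (σ₁ ∷ (σ₂ ∷ [])) ≡ eval b (σ₂ ∷ (σ₁ ∷ [])))
Cons (suc (suc (suc zero))) B b =
  MultiT 3 B b ×
  (∀ j → j ∈ B → Cons 2 (B - j) (b ·e j)) ×
  (∀ j₁ j₂ j₃ →
     (eval b (e j₁ ∷ (e j₂ ∷ (e j₃ ∷ []))) xor
      eval b (e j₃ ∷ (e j₁ ∷ (e j₂ ∷ []))) xor
      eval b (e j₂ ∷ (e j₃ ∷ (e j₁ ∷ [])))) ≡ false)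
Cons (suc (suc (suc (suc k)))) B b =
  MultiT (suc (suc (suc (suc k)))) B b ×
  (∀ j → j ∈ B → Cons (suc (suc (suc k))) (B - j) (b ·e j)) ×
  (∀ j₁ j₂ → j₁ ∈ B → j₂ ∈ B → ¬ (j₁ ≡ j₂) → (b ·e j₁ ·e j₂) ≈ (b ·e j₂ ·e j₁))

module Submission where

-- For i = 1 both sides are Gov(V_B, 1) by definition.  For i = k + 2 both
-- are identified with one explicit class of tensors.  A tuple τ : [k+2] → [n]
-- is admissible over B if it is injective with values in B, and a weight is
-- any w : Subset n → Fin n → F₂.  The tensor of image form with weight w
-- takes at admissible τ the value  w(im τ, τ_{k+1}) + w(im τ, τ_{k+2})  and
-- vanishes at all other tuples.
--
--  * φ_(A,x) has image form with weight the indicator of (A, x); image form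
--    is linear in the weight, so Gov ⊆ image form.  Conversely a tensor of
--    image form is the sum of the φ_(A,x) over the governing pairs (A, x)
--    with w(A, x) = 1.
--  * A tensor of image form is consistent: its slices b(e_j, -) again have
--    image form, and symmetry, the cyclic identity and the exchange of the
--    first two entries hold because the value only depends on im τ and the
--    unordered pair of last entries.
--  * A consistent tensor has image form.  By induction on the order (slicing
--    at the first entry and using the exchange of the first two entries) its
--    value at admissible τ depends only on im τ and the unordered last pair;
--    the cyclic identity holds in all orders ≥ 3.  The weight w(S, y) is the
--    value at a tuple with image S ending in (min S, y), and the cyclic
--    identity moves min S into the last pair.

open import Defs
open import Data.Nat using (ℕ; _≤_)
open import Data.Fin.Subset using (Subset)
open import Data.Product using (_×_)

open import Algebra.Bundles using (CommutativeRing)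
open import Data.Bool as Bool using (Bool; true; false; _∧_; _∨_; _xor_; not; if_then_else_)
open import Data.Bool.Properties
  using ( ¬-not; ∧-assoc; ∧-comm; ∧-identityʳ; ∧-zeroʳ; ∧-distribˡ-xor
        ; xor-assoc; xor-comm; xor-identityʳ; xor-∧-commutativeRing)
open import Algebra.Properties.CommutativeSemigroup
  (CommutativeRing.+-commutativeSemigroup xor-∧-commutativeRing) using (interchange)
open import Data.Empty using (⊥; ⊥-elim)
open import Data.Fin as F using (Fin; zero; suc; fromℕ; inject₁)
import Data.Fin.Properties as FP
open import Data.Fin.Subset using (_∈_; _⊆_; _-_; _─_; ⁅_⁆; ∣_∣)
open import Data.Fin.Subset.Properties using (_∈?_; _⊆?_)
import Data.Nat as ℕ
open import Data.Nat using (zero; suc)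
open import Data.Product using (_,_; proj₁; proj₂; ∃-syntax)
open import Data.Sum using (_⊎_; inj₁; inj₂)
open import Data.Vec using (lookup; tabulate) renaming ([] to []ᵥ; _∷_ to _∷ᵥ_)
import Data.Vec.Properties as VP
open import Data.Vec.Functional using ([]; _∷_)
open import Function using (_∘_; id)
open import Data.List as L using (List; _++_; foldr) renaming ([] to []ₗ; _∷_ to _∷ₗ_)
open import Data.List.Relation.Unary.All as All using (All) renaming ([] to []ᵃ; _∷_ to _∷ᵃ_)
import Data.List.Relation.Unary.All.Properties as AllP
open import Relation.Nullary using (¬_; Dec; yes; no; does)
open import Relation.Nullary.Decidable using (dec-true; dec-false)
open import Relation.Binary.PropositionalEquality
  using (_≡_; _≢_; _≗_; refl; sym; trans; cong; cong₂; subst; subst₂; module ≡-Reasoning)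
open ≡-Reasoning

true≢false : true ≢ false
true≢false ()

bool-ext : ∀ {a b : Bool} → (a ≡ true → b ≡ true) → (b ≡ true → a ≡ true) → a ≡ b
bool-ext {true}  {true}  _ _ = refl
bool-ext {true}  {false} f _ = sym (f refl)
bool-ext {false} {true}  _ g = g refl
bool-ext {false} {false} _ _ = refl

≢true⇒≡false : ∀ {a : Bool} → ¬ (a ≡ true) → a ≡ false
≢true⇒≡false = ¬-not

∧-trueˡ : ∀ {a b : Bool} → (a ∧ b) ≡ true → a ≡ true
∧-trueˡ {true} _ = refl

∧-trueʳ : ∀ {a b : Bool} → (a ∧ b) ≡ true → b ≡ true
∧-trueʳ {true} p = p

∧-true : ∀ {a b : Bool} → a ≡ true → b ≡ true → (a ∧ b) ≡ true
∧-true refl refl = refl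

∨-trueˡ : ∀ {a b : Bool} → (a ∨ b) ≡ true → b ≡ false → a ≡ true
∨-trueˡ {true}  _ _    = refl
∨-trueˡ {false} p refl = p

∨-trueʳ : ∀ {a b : Bool} → (a ∨ b) ≡ true → a ≡ false → b ≡ true
∨-trueʳ {false} p refl = p

xor-true : ∀ {a b : Bool} → (a xor b) ≡ true → (a ≡ true) ⊎ (b ≡ true)
xor-true {true}  _ = inj₁ refl
xor-true {false} p = inj₂ p

does⇒ : ∀ {P : Set} (d : Dec P) → does d ≡ true → P
does⇒ (yes p) _ = p

==-refl : ∀ {n} (x : Fin n) → (x == x) ≡ true
==-refl x = dec-true (x F.≟ x) refl

≡⇒== : ∀ {n} {x y : Fin n} → x ≡ y → (x == y) ≡ true
≡⇒== {x = x} {y} = dec-true (x F.≟ y)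

≢⇒== : ∀ {n} {x y : Fin n} → x ≢ y → (x == y) ≡ false
≢⇒== {x = x} {y} = dec-false (x F.≟ y)

==⇒≡ : ∀ {n} {x y : Fin n} → (x == y) ≡ true → x ≡ y
==⇒≡ {x = x} {y} p with x F.≟ y
... | yes x≡y = x≡y

==-sym : ∀ {n} (x y : Fin n) → (x == y) ≡ (y == x)
==-sym x y = bool-ext (λ p → ≡⇒== (sym (==⇒≡ {x = x} p))) (λ p → ≡⇒== (sym (==⇒≡ {x = y} p)))

prod-true : ∀ k (f : Fin k → Bool) → prodFin k f ≡ true → ∀ l → f l ≡ true
prod-true (suc k) f p zero    = ∧-trueˡ p
prod-true (suc k) f p (suc l) = prod-true k (f ∘ suc) (∧-trueʳ {f zero} p) l

true-prod : ∀ k (f : Fin k → Bool) → (∀ l → f l ≡ true) → prodFin k f ≡ true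
true-prod zero    f _   = refl
true-prod (suc k) f all = ∧-true (all zero) (true-prod k (f ∘ suc) (all ∘ suc))

prod-cong : ∀ k {f g : Fin k → Bool} → f ≗ g → prodFin k f ≡ prodFin k g
prod-cong zero    _   = refl
prod-cong (suc k) f≗g = cong₂ _∧_ (f≗g zero) (prod-cong k (f≗g ∘ suc))

any-true : ∀ k (f : Fin k → Bool) → anyFin k f ≡ true → ∃[ l ] f l ≡ true
any-true (suc k) f p with f zero in eq
... | true  = zero , eq
... | false = let (l , q) = any-true k (f ∘ suc) p in suc l , q

true-any : ∀ k (f : Fin k → Bool) l → f l ≡ true → anyFin k f ≡ true
true-any (suc k) f zero    p rewrite p = refl
true-any (suc k) f (suc l) p with f zero
... | true  = refl
... | false = true-any k (f ∘ suc) l p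

any-cong : ∀ k {f g : Fin k → Bool} → f ≗ g → anyFin k f ≡ anyFin k g
any-cong zero    _   = refl
any-cong (suc k) f≗g = cong₂ _∨_ (f≗g zero) (any-cong k (f≗g ∘ suc))

sum-cong : ∀ k {f g : Fin k → Bool} → f ≗ g → sumFin k f ≡ sumFin k g
sum-cong zero    _   = refl
sum-cong (suc k) f≗g = cong₂ _xor_ (f≗g zero) (sum-cong k (f≗g ∘ suc))

sum-zero : ∀ k (f : Fin k → Bool) → (∀ l → f l ≡ false) → sumFin k f ≡ false
sum-zero zero    f _      = refl
sum-zero (suc k) f vanish = cong₂ _xor_ (vanish zero) (sum-zero k (f ∘ suc) (vanish ∘ suc))

sum-xor : ∀ k (f g : Fin k → Bool) → sumFin k (λ l → f l xor g l) ≡ (sumFin k f xor sumFin k g)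
sum-xor zero    f g = refl
sum-xor (suc k) f g =
  trans (cong ((f zero xor g zero) xor_) (sum-xor k (f ∘ suc) (g ∘ suc)))
        (interchange (f zero) (g zero) _ _)

sum-scale : ∀ k c (f : Fin k → Bool) → sumFin k (λ l → c ∧ f l) ≡ (c ∧ sumFin k f)
sum-scale zero    c f = sym (∧-zeroʳ c)
sum-scale (suc k) c f =
  trans (cong ((c ∧ f zero) xor_) (sum-scale k c (f ∘ suc))) (sym (∧-distribˡ-xor c _ _))

sum-delta : ∀ k (x : Fin k) (f : Fin k → Bool) → sumFin k (λ j → (j == x) ∧ f j) ≡ f x
sum-delta (suc k) zero    f = trans (cong (f zero xor_) (sum-zero k _ (λ _ → refl))) (xor-identityʳ (f zero))
sum-delta (suc k) (suc x) f = sum-delta k x (f ∘ suc)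

sum-swap : ∀ m m' (F : Fin m → Fin m' → Bool) →
           sumFin m (λ j → sumFin m' (F j)) ≡ sumFin m' (λ l → sumFin m (λ j → F j l))
sum-swap zero    m' F = sym (sum-zero m' _ (λ _ → refl))
sum-swap (suc m) m' F =
  trans (cong (sumFin m' (F zero) xor_) (sum-swap m m' (F ∘ suc))) (sym (sum-xor m' _ _))

Map : ℕ → ℕ → Set
Map n i = Fin i → Fin n

Extensional : ∀ {n i} → (Map n i → Bool) → Set
Extensional F = ∀ τ τ' → τ ≗ τ' → F τ ≡ F τ'

∷-≗ : ∀ {n i} (j : Fin n) {τ τ' : Map n i} → τ ≗ τ' → (j ∷ τ) ≗ (j ∷ τ')
∷-≗ j τ≗τ' zero    = refl
∷-≗ j τ≗τ' (suc h) = τ≗τ' h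

head∷tail : ∀ {n i} (ρ : Map n (suc i)) → (ρ zero ∷ ρ ∘ suc) ≗ ρ
head∷tail ρ zero    = refl
head∷tail ρ (suc h) = refl

sumMaps-cong : ∀ n i {F G : Map n i → Bool} → (∀ τ → F τ ≡ G τ) → sumMaps n i F ≡ sumMaps n i G
sumMaps-cong n zero    F≗G = F≗G _
sumMaps-cong n (suc i) F≗G = sum-cong n (λ j → sumMaps-cong n i (λ τ → F≗G (j ∷ τ)))

sumMaps-scale : ∀ n i c (F : Map n i → Bool) → sumMaps n i (λ τ → c ∧ F τ) ≡ (c ∧ sumMaps n i F)
sumMaps-scale n zero    c F = refl
sumMaps-scale n (suc i) c F =
  trans (sum-cong n (λ j → sumMaps-scale n i c (λ τ → F (j ∷ τ)))) (sum-scale n c _)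

sumMaps-delta : ∀ n i (F : Map n i → Bool) → Extensional F → ∀ ρ →
                sumMaps n i (λ τ → F τ ∧ prodFin i (λ h → τ h == ρ h)) ≡ F ρ
sumMaps-delta n zero    F ext ρ = trans (∧-identityʳ _) (ext _ _ (λ ()))
sumMaps-delta n (suc i) F ext ρ = begin
  sumFin n (λ j → sumMaps n i (λ τ → F (j ∷ τ) ∧ ((j == ρ zero) ∧ δ τ)))
    ≡⟨ sum-cong n (λ j → trans (sumMaps-cong n i (λ τ → ∧-swap (F (j ∷ τ)) (j == ρ zero) (δ τ)))
                               (sumMaps-scale n i (j == ρ zero) _)) ⟩
  sumFin n (λ j → (j == ρ zero) ∧ sumMaps n i (λ τ → F (j ∷ τ) ∧ δ τ))
    ≡⟨ sum-delta n (ρ zero) _ ⟩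
  sumMaps n i (λ τ → F (ρ zero ∷ τ) ∧ δ τ)
    ≡⟨ sumMaps-delta n i (λ τ → F (ρ zero ∷ τ)) (λ τ τ' eq → ext _ _ (∷-≗ (ρ zero) eq)) (ρ ∘ suc) ⟩
  F (ρ zero ∷ ρ ∘ suc)
    ≡⟨ ext _ _ (head∷tail ρ) ⟩
  F ρ ∎
  where
  δ : Map n i → Bool
  δ τ = prodFin i (λ h → τ h == ρ (suc h))
  ∧-swap : ∀ a c p → (a ∧ (c ∧ p)) ≡ (c ∧ (a ∧ p))
  ∧-swap a c p = trans (sym (∧-assoc a c p)) (trans (cong (_∧ p) (∧-comm a c)) (∧-assoc c a p))

anyMaps : ∀ n i → (Map n i → Bool) → Bool
anyMaps n zero    F = F (λ ())
anyMaps n (suc i) F = anyFin n (λ j → anyMaps n i (λ τ → F (j ∷ τ)))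

anyMaps-true : ∀ n i (F : Map n i → Bool) → anyMaps n i F ≡ true → ∃[ τ ] F τ ≡ true
anyMaps-true n zero    F p = _ , p
anyMaps-true n (suc i) F p =
  let (j , q) = any-true n _ p
      (τ , r) = anyMaps-true n i (λ τ → F (j ∷ τ)) q
  in (j ∷ τ) , r

true-anyMaps : ∀ n i (F : Map n i → Bool) → Extensional F → ∀ ρ → F ρ ≡ true → anyMaps n i F ≡ true
true-anyMaps n zero    F ext ρ p = trans (ext _ _ (λ ())) p
true-anyMaps n (suc i) F ext ρ p =
  true-any n _ (ρ zero)
    (true-anyMaps n i (λ τ → F (ρ zero ∷ τ)) (λ τ τ' eq → ext _ _ (∷-≗ (ρ zero) eq)) (ρ ∘ suc)
      (trans (ext _ _ (head∷tail ρ)) p))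

∈⇒true : ∀ {n} {x : Fin n} {p : Subset n} → x ∈ p → lookup p x ≡ true
∈⇒true = VP.[]=⇒lookup

true⇒∈ : ∀ {n} {x : Fin n} {p : Subset n} → lookup p x ≡ true → x ∈ p
true⇒∈ {x = x} {p} = VP.lookup⇒[]= x p

_≟ₛ_ : ∀ {n} (S A : Subset n) → Dec (S ≡ A)
_≟ₛ_ = VP.≡-dec Bool._≟_

lookup-⁅⁆ : ∀ {n} (j x : Fin n) → lookup ⁅ j ⁆ x ≡ (j == x)
lookup-⁅⁆ zero    zero    = refl
lookup-⁅⁆ zero    (suc x) = VP.lookup-replicate x false
lookup-⁅⁆ (suc j) zero    = refl
lookup-⁅⁆ (suc j) (suc x) = lookup-⁅⁆ j x

lookup-minus : ∀ {n} (p : Subset n) (j x : Fin n) → lookup (p - j) x ≡ (lookup p x ∧ not (j == x))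
lookup-minus p j x =
  trans (VP.lookup-zipWith _ x p ⁅ j ⁆)
        (trans (difference (lookup p x) (lookup ⁅ j ⁆ x)) (cong (λ c → lookup p x ∧ not c) (lookup-⁅⁆ j x)))
  where
  difference : ∀ a c → lookup ((a ∷ᵥ []ᵥ) ─ (c ∷ᵥ []ᵥ)) zero ≡ (a ∧ not c)
  difference a true  = sym (∧-zeroʳ a)
  difference a false = sym (∧-identityʳ a)

-- Admissible tuples: injective with entries in B.  They index the basis
-- tensors χ_{τ(1)} ⊗ … ⊗ χ_{τ(i)} spanning Multi(V_B, i).

Into : ∀ {n i} → Subset n → Map n i → Set
Into B τ = ∀ h → lookup B (τ h) ≡ true

Admissible : ∀ {n i} → Subset n → Map n i → Set
Admissible B τ = Injective τ × Into B τ

intoB : ∀ {n i} → Subset n → Map n i → Bool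
intoB {i = i} B τ = prodFin i (λ h → lookup B (τ h))

admissible : ∀ {n i} → Subset n → Map n i → Bool
admissible B τ = injB τ ∧ intoB B τ

injB-true : ∀ {n i} (τ : Map n i) → injB τ ≡ true → Injective τ
injB-true {i = i} τ p h h' τh≡τh' =
  ==⇒≡ (∨-trueˡ (prod-true i _ (prod-true i _ p h) h') (cong not (≡⇒== τh≡τh')))

true-injB : ∀ {n i} (τ : Map n i) → Injective τ → injB τ ≡ true
true-injB {i = i} τ inj = true-prod i _ λ h → true-prod i _ λ h' → separated h h'
  where
  separated : ∀ h h' → ((h == h') ∨ not (τ h == τ h')) ≡ true
  separated h h' with h F.≟ h'
  ... | yes _   = refl
  ... | no h≢h' rewrite ≢⇒== (h≢h' ∘ inj h h') = refl

injB-cong : ∀ {n i} → Extensional (injB {n} {i})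
injB-cong {i = i} τ τ' τ≗τ' =
  prod-cong i λ h → prod-cong i λ h' → cong₂ (λ a b → (h == h') ∨ not (a == b)) (τ≗τ' h) (τ≗τ' h')

admissible-cong : ∀ {n i} (B : Subset n) → Extensional (admissible {n} {i} B)
admissible-cong {i = i} B τ τ' τ≗τ' = cong₂ _∧_ (injB-cong τ τ' τ≗τ') (prod-cong i (cong (lookup B) ∘ τ≗τ'))

admissible⇒ : ∀ {n i} (B : Subset n) (τ : Map n i) → admissible B τ ≡ true → Admissible B τ
admissible⇒ {i = i} B τ p = injB-true τ (∧-trueˡ p) , prod-true i _ (∧-trueʳ {injB τ} p)

⇒admissible : ∀ {n i} (B : Subset n) (τ : Map n i) → Admissible B τ → admissible B τ ≡ true
⇒admissible {i = i} B τ (inj , into) = ∧-true (true-injB τ inj) (true-prod i _ into)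

tail-admissible : ∀ {n i} (B : Subset n) (τ : Map n (suc i)) → Admissible B τ →
                  Admissible (B - τ zero) (τ ∘ suc)
tail-admissible B τ (inj , into) =
  (λ h h' eq → FP.suc-injective (inj _ _ eq)) ,
  (λ h → trans (lookup-minus B (τ zero) (τ (suc h)))
               (cong₂ _∧_ (into (suc h)) (cong not (≢⇒== (λ eq → zero≢suc (inj _ _ eq))))))
  where
  zero≢suc : ∀ {m} {x : Fin m} → zero ≢ suc x
  zero≢suc ()

admissible-∷ : ∀ {n i} (B : Subset n) (j : Fin n) (τ : Map n i) → lookup B j ≡ true →
               admissible B (j ∷ τ) ≡ admissible (B - j) τ
admissible-∷ B j τ j∈B = bool-ext
  (λ p → ⇒admissible (B - j) τ (tail-admissible B (j ∷ τ) (admissible⇒ B (j ∷ τ) p)))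
  (λ p → ⇒admissible B (j ∷ τ) (extend (admissible⇒ (B - j) τ p)))
  where
  avoids : ∀ h → lookup (B - j) (τ h) ≡ true → j ≢ τ h
  avoids h p j≡τh = true≢false (trans (sym p) (trans (lookup-minus B j (τ h))
                      (trans (cong (λ c → lookup B (τ h) ∧ not c) (≡⇒== j≡τh)) (∧-zeroʳ _))))
  extend : Admissible (B - j) τ → Admissible B (j ∷ τ)
  extend (inj , into) = inj′ , into′
    where
    inj′ : Injective (j ∷ τ)
    inj′ zero    zero     _  = refl
    inj′ zero    (suc h') eq = ⊥-elim (avoids h' (into h') eq)
    inj′ (suc h) zero     eq = ⊥-elim (avoids h (into h) (sym eq))
    inj′ (suc h) (suc h') eq = cong suc (inj h h' eq)
    into′ : Into B (j ∷ τ)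
    into′ zero    = j∈B
    into′ (suc h) = ∧-trueˡ {lookup B (τ h)} (trans (sym (lookup-minus B j (τ h))) (into h))

image : ∀ {n i} → Map n i → Subset n
image {i = i} τ = tabulate (λ a → anyFin i (λ l → τ l == a))

image-true : ∀ {n i} (τ : Map n i) a → lookup (image τ) a ≡ true → ∃[ l ] τ l ≡ a
image-true {i = i} τ a p =
  let (l , q) = any-true i _ (trans (sym (VP.lookup∘tabulate _ a)) p) in l , ==⇒≡ q

true-image : ∀ {n i} (τ : Map n i) l → lookup (image τ) (τ l) ≡ true
true-image {i = i} τ l = trans (VP.lookup∘tabulate _ (τ l)) (true-any i _ l (==-refl (τ l)))

image-cong : ∀ {n i} (τ τ' : Map n i) → τ ≗ τ' → image τ ≡ image τ'
image-cong {i = i} τ τ' τ≗τ' = VP.tabulate-cong (λ a → any-cong i (λ l → cong (_== a) (τ≗τ' l)))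

image-ext : ∀ {n i} (τ τ' : Map n i) → (∀ l → ∃[ l' ] τ' l' ≡ τ l) → (∀ l → ∃[ l' ] τ l' ≡ τ' l) →
            image τ ≡ image τ'
image-ext {i = i} τ τ' τ⊆τ' τ'⊆τ = VP.tabulate-cong (λ a → bool-ext (move τ τ' τ⊆τ' a) (move τ' τ τ'⊆τ a))
  where
  move : ∀ σ σ' → (∀ l → ∃[ l' ] σ' l' ≡ σ l) → ∀ a →
         anyFin i (λ l → σ l == a) ≡ true → anyFin i (λ l → σ' l == a) ≡ true
  move σ σ' σ⊆σ' a p =
    let (l , q) = any-true i _ p
        (l' , r) = σ⊆σ' l
    in true-any i _ l' (≡⇒== (trans r (==⇒≡ q)))

image-≡⇒ : ∀ {n i} (τ τ' : Map n i) → image τ ≡ image τ' → ∀ l → ∃[ l' ] τ' l' ≡ τ l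
image-≡⇒ τ τ' eq l = image-true τ' (τ l) (subst (λ S → lookup S (τ l) ≡ true) eq (true-image τ l))

tail-image : ∀ {n i} (τ τ' : Map n (suc i)) → Injective τ → Injective τ' → τ zero ≡ τ' zero →
             image τ ≡ image τ' → image (τ ∘ suc) ≡ image (τ' ∘ suc)
tail-image τ τ' inj inj' head≡ eq =
  image-ext (τ ∘ suc) (τ' ∘ suc) (move τ τ' inj head≡ eq) (move τ' τ inj' (sym head≡) (sym eq))
  where
  move : ∀ σ σ' → Injective σ → σ zero ≡ σ' zero → image σ ≡ image σ' →
         ∀ l → ∃[ l' ] σ' (suc l') ≡ σ (suc l)
  move σ σ' injσ head≡ eq l with image-≡⇒ σ σ' eq (suc l)
  ... | suc l' , r = l' , r
  ... | zero   , r with injσ zero (suc l) (trans head≡ r)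
  ...   | ()

penult : ∀ k → Fin (suc (suc k))
penult k = inject₁ (fromℕ k)

final : ∀ k → Fin (suc (suc k))
final k = fromℕ (suc k)

antepenult : ∀ k → Fin (suc (suc (suc k)))
antepenult k = inject₁ (inject₁ (fromℕ k))

penult≢final : ∀ k → penult k ≢ final k
penult≢final zero    ()
penult≢final (suc k) = penult≢final k ∘ FP.suc-injective

antepenult≢penult : ∀ k → antepenult k ≢ penult (suc k)
antepenult≢penult zero    ()
antepenult≢penult (suc k) = antepenult≢penult k ∘ FP.suc-injective

antepenult≢final : ∀ k → antepenult k ≢ final (suc k)
antepenult≢final zero    ()
antepenult≢final (suc k) = antepenult≢final k ∘ FP.suc-injective

swapIx : ∀ {m} → Fin m → Fin m → Fin m → Fin m
swapIx u v l = if l == u then v else (if l == v then u else l)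

swapIx-u : ∀ {m} (u v : Fin m) → swapIx u v u ≡ v
swapIx-u u v rewrite ==-refl u = refl

swapIx-v : ∀ {m} (u v : Fin m) → swapIx u v v ≡ u
swapIx-v u v with v F.≟ u
... | yes v≡u = v≡u
... | no _ rewrite ==-refl v = refl

swapIx-other : ∀ {m} (u v l : Fin m) → l ≢ u → l ≢ v → swapIx u v l ≡ l
swapIx-other u v l l≢u l≢v rewrite ≢⇒== l≢u | ≢⇒== l≢v = refl

swapIx-involutive : ∀ {m} (u v l : Fin m) → swapIx u v (swapIx u v l) ≡ l
swapIx-involutive u v l = by-cases (l F.≟ u) (l F.≟ v)
  where
  by-cases : Dec (l ≡ u) → Dec (l ≡ v) → swapIx u v (swapIx u v l) ≡ l
  by-cases (yes refl) _          = trans (cong (swapIx l v) (swapIx-u l v)) (swapIx-v l v)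
  by-cases (no _)     (yes refl) = trans (cong (swapIx u l) (swapIx-v u l)) (swapIx-u u l)
  by-cases (no l≢u)   (no l≢v)   =
    trans (cong (swapIx u v) (swapIx-other u v l l≢u l≢v)) (swapIx-other u v l l≢u l≢v)

swapIx-suc : ∀ {m} (u v h : Fin m) → swapIx (suc u) (suc v) (suc h) ≡ suc (swapIx u v h)
swapIx-suc u v h with h == u
... | true  = refl
... | false with h == v
...   | true  = refl
...   | false = refl

swapAt : ∀ {n i} → Fin i → Fin i → Map n i → Map n i
swapAt u v τ = τ ∘ swapIx u v

swap-≗ : ∀ {n i} (u v : Fin i) {τ τ' : Map n i} → τ ≗ τ' → swapAt u v τ ≗ swapAt u v τ'
swap-≗ u v τ≗τ' h = τ≗τ' _

swap-suc : ∀ {n i} (u v : Fin i) (τ : Map n (suc i)) →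
           swapAt (suc u) (suc v) τ ≗ (τ zero ∷ swapAt u v (τ ∘ suc))
swap-suc u v τ zero    = refl
swap-suc u v τ (suc h) = cong τ (swapIx-suc u v h)

swap-admissible : ∀ {n i} (B : Subset n) (u v : Fin i) (τ : Map n i) → Admissible B τ → Admissible B (swapAt u v τ)
swap-admissible B u v τ (inj , into) =
  (λ h h' eq → trans (sym (swapIx-involutive u v h))
                     (trans (cong (swapIx u v) (inj _ _ eq)) (swapIx-involutive u v h'))) ,
  into ∘ swapIx u v

admissible-swap : ∀ {n i} (B : Subset n) (u v : Fin i) (τ : Map n i) → admissible B (swapAt u v τ) ≡ admissible B τ
admissible-swap B u v τ = bool-ext
  (λ p → trans (admissible-cong B τ (swapAt u v (swapAt u v τ)) (λ h → cong τ (sym (swapIx-involutive u v h))))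
               (⇒admissible B _ (swap-admissible B u v _ (admissible⇒ B _ p))))
  (λ p → ⇒admissible B _ (swap-admissible B u v τ (admissible⇒ B τ p)))

image-swap : ∀ {n i} (u v : Fin i) (τ : Map n i) → image (swapAt u v τ) ≡ image τ
image-swap u v τ = image-ext (swapAt u v τ) τ
  (λ l → swapIx u v l , refl)
  (λ l → swapIx u v l , cong τ (swapIx-involutive u v l))

LastSame : ∀ {n} k → Map n (suc (suc k)) → Map n (suc (suc k)) → Set
LastSame k τ τ' = (τ' (penult k) ≡ τ (penult k) × τ' (final k) ≡ τ (final k))
                ⊎ (τ' (penult k) ≡ τ (final k) × τ' (final k) ≡ τ (penult k))

lastSame-sym : ∀ {n} k {τ τ' : Map n (suc (suc k))} → LastSame k τ τ' → LastSame k τ' τ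
lastSame-sym k (inj₁ (p , q)) = inj₁ (sym p , sym q)
lastSame-sym k (inj₂ (p , q)) = inj₂ (sym q , sym p)

lastSame-trans : ∀ {n} k {τ τ' τ'' : Map n (suc (suc k))} → LastSame k τ τ' → LastSame k τ' τ'' → LastSame k τ τ''
lastSame-trans k (inj₁ (p , q)) (inj₁ (r , s)) = inj₁ (trans r p , trans s q)
lastSame-trans k (inj₁ (p , q)) (inj₂ (r , s)) = inj₂ (trans r q , trans s p)
lastSame-trans k (inj₂ (p , q)) (inj₁ (r , s)) = inj₂ (trans r p , trans s q)
lastSame-trans k (inj₂ (p , q)) (inj₂ (r , s)) = inj₁ (trans r q , trans s p)

sumOver : ∀ {I : Set} → (I → Bool) → List I → Bool
sumOver v = foldr (λ a acc → v a xor acc) false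

catFin : ∀ {I : Set} m → (Fin m → List I) → List I
catFin zero    f = []ₗ
catFin (suc m) f = f zero ++ catFin m (f ∘ suc)

catSub : ∀ {I : Set} m → (Subset m → List I) → List I
catSub zero    f = f []ᵥ
catSub (suc m) f = catSub m (f ∘ (false ∷ᵥ_)) ++ catSub m (f ∘ (true ∷ᵥ_))

onlyIf : ∀ {I : Set} → Bool → I → List I
onlyIf true  a = a ∷ₗ []ₗ
onlyIf false a = []ₗ

All-catFin : ∀ {I : Set} {P : I → Set} m (f : Fin m → List I) → (∀ j → All P (f j)) → All P (catFin m f)
All-catFin zero    f all = []ᵃ
All-catFin (suc m) f all = AllP.++⁺ (all zero) (All-catFin m (f ∘ suc) (all ∘ suc))

All-catSub : ∀ {I : Set} {P : I → Set} m (f : Subset m → List I) → (∀ S → All P (f S)) → All P (catSub m f)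
All-catSub zero    f all = all []ᵥ
All-catSub (suc m) f all =
  AllP.++⁺ (All-catSub m _ (all ∘ (false ∷ᵥ_))) (All-catSub m _ (all ∘ (true ∷ᵥ_)))

All-onlyIf : ∀ {I : Set} {P : I → Set} c a → (c ≡ true → P a) → All P (onlyIf c a)
All-onlyIf true  a pa = pa refl ∷ᵃ []ᵃ
All-onlyIf false a _  = []ᵃ

sumSub : ∀ m → (Subset m → Bool) → Bool
sumSub zero    F = F []ᵥ
sumSub (suc m) F = sumSub m (F ∘ (false ∷ᵥ_)) xor sumSub m (F ∘ (true ∷ᵥ_))

sumSub-cong : ∀ m {F G : Subset m → Bool} → (∀ A → F A ≡ G A) → sumSub m F ≡ sumSub m G
sumSub-cong zero    F≗G = F≗G []ᵥ
sumSub-cong (suc m) F≗G = cong₂ _xor_ (sumSub-cong m (F≗G ∘ (false ∷ᵥ_))) (sumSub-cong m (F≗G ∘ (true ∷ᵥ_)))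

sumSub-zero : ∀ m → sumSub m (λ _ → false) ≡ false
sumSub-zero zero    = refl
sumSub-zero (suc m) = cong₂ _xor_ (sumSub-zero m) (sumSub-zero m)

sumSub-delta : ∀ m (S : Subset m) (G : Subset m → Bool) → sumSub m (λ A → does (S ≟ₛ A) ∧ G A) ≡ G S
sumSub-delta zero    []ᵥ          G = refl
sumSub-delta (suc m) (false ∷ᵥ S) G =
  trans (cong₂ _xor_ (sumSub-delta m S (G ∘ (false ∷ᵥ_))) (sumSub-zero m)) (xor-identityʳ _)
sumSub-delta (suc m) (true ∷ᵥ S)  G = cong₂ _xor_ (sumSub-zero m) (sumSub-delta m S (G ∘ (true ∷ᵥ_)))

sumOver-++ : ∀ {I : Set} (v : I → Bool) xs ys → sumOver v (xs ++ ys) ≡ (sumOver v xs xor sumOver v ys)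
sumOver-++ v []ₗ       ys = refl
sumOver-++ v (x ∷ₗ xs) ys = trans (cong (v x xor_) (sumOver-++ v xs ys)) (sym (xor-assoc (v x) _ _))

sumOver-map : ∀ {I J : Set} (v : I → Bool) (f : J → I) xs → sumOver v (L.map f xs) ≡ sumOver (v ∘ f) xs
sumOver-map v f []ₗ       = refl
sumOver-map v f (x ∷ₗ xs) = cong (v (f x) xor_) (sumOver-map v f xs)

sumOver-catFin : ∀ {I : Set} (v : I → Bool) m (f : Fin m → List I) →
                 sumOver v (catFin m f) ≡ sumFin m (λ j → sumOver v (f j))
sumOver-catFin v zero    f = refl
sumOver-catFin v (suc m) f =
  trans (sumOver-++ v (f zero) _) (cong (sumOver v (f zero) xor_) (sumOver-catFin v m (f ∘ suc)))

sumOver-catSub : ∀ {I : Set} (v : I → Bool) m (f : Subset m → List I) →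
                 sumOver v (catSub m f) ≡ sumSub m (λ A → sumOver v (f A))
sumOver-catSub v zero    f = refl
sumOver-catSub v (suc m) f =
  trans (sumOver-++ v (catSub m (f ∘ (false ∷ᵥ_))) _)
        (cong₂ _xor_ (sumOver-catSub v m (f ∘ (false ∷ᵥ_))) (sumOver-catSub v m (f ∘ (true ∷ᵥ_))))

sumOver-onlyIf : ∀ {I : Set} (v : I → Bool) c a → sumOver v (onlyIf c a) ≡ (c ∧ v a)
sumOver-onlyIf v true  a = xor-identityʳ _
sumOver-onlyIf v false a = refl

sumList-at : ∀ {n i} {I : Set} (gen : I → Tensor n i) as τ → sumList gen as τ ≡ sumOver (λ a → gen a τ) as
sumList-at gen []ₗ       τ = refl
sumList-at gen (a ∷ₗ as) τ = cong (gen a τ xor_) (sumList-at gen as τ)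

-- Elements of Multi(V_B, i) are exactly the extensional tensors supported
-- on admissible tuples.

admissible-≗ : ∀ {n i} {B : Subset n} {σ τ : Map n i} → σ ≗ τ → Admissible B σ → Admissible B τ
admissible-≗ {B = B} σ≗τ (inj , into) =
  (λ h h' eq → inj h h' (trans (σ≗τ h) (trans eq (sym (σ≗τ h'))))) ,
  (λ h → subst (λ z → lookup B z ≡ true) (σ≗τ h) (into h))

injInto⇒admissible : ∀ {n i} {B : Subset n} {τ : Map n i} → InjInto B τ → Admissible B τ
injInto⇒admissible (inj , mem) = inj , ∈⇒true ∘ mem

χ⊗-true : ∀ {n i} (σ τ : Map n i) → χ⊗ σ τ ≡ true → σ ≗ τ
χ⊗-true {i = i} σ τ p h = ==⇒≡ (prod-true i _ p h)

sumList-χ⊗-cong : ∀ {n i} (as : List (Map n i)) → Extensional (sumList χ⊗ as)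
sumList-χ⊗-cong []ₗ               τ τ' τ≗τ' = refl
sumList-χ⊗-cong {i = i} (a ∷ₗ as) τ τ' τ≗τ' =
  cong₂ _xor_ (prod-cong i (λ h → cong (a h ==_) (τ≗τ' h))) (sumList-χ⊗-cong as τ τ' τ≗τ')

sumList-χ⊗-supp : ∀ {n i} (B : Subset n) (as : List (Map n i)) → All (InjInto B) as →
                  ∀ τ → sumList χ⊗ as τ ≡ true → Admissible B τ
sumList-χ⊗-supp B (a ∷ₗ as) (a-ok ∷ᵃ oks) τ p with xor-true {χ⊗ a τ} p
... | inj₁ q = admissible-≗ {B = B} (χ⊗-true a τ q) (injInto⇒admissible {B = B} a-ok)
... | inj₂ q = sumList-χ⊗-supp B as oks τ q

multi-ext : ∀ {n i} {B : Subset n} {b : Tensor n i} → MultiT i B b → Extensional b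
multi-ext (as , _ , b≈) τ τ' τ≗τ' = trans (b≈ τ) (trans (sumList-χ⊗-cong as τ τ' τ≗τ') (sym (b≈ τ')))

multi-supp : ∀ {n i} {B : Subset n} {b : Tensor n i} → MultiT i B b → ∀ τ → b τ ≡ true → Admissible B τ
multi-supp {B = B} (as , oks , b≈) τ p = sumList-χ⊗-supp B as oks τ (trans (sym (b≈ τ)) p)

listMaps : ∀ n i → (Map n i → Bool) → List (Map n i)
listMaps n zero    p = onlyIf (p (λ ())) (λ ())
listMaps n (suc i) p = catFin n (λ j → L.map (j ∷_) (listMaps n i (λ τ → p (j ∷ τ))))

All-listMaps : ∀ n i (p : Map n i → Bool) → All (λ σ → p σ ≡ true) (listMaps n i p)
All-listMaps n zero    p = All-onlyIf (p (λ ())) (λ ()) (λ q → q)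
All-listMaps n (suc i) p = All-catFin n _ (λ j → AllP.map⁺ (All-listMaps n i (λ τ → p (j ∷ τ))))

sumOver-listMaps : ∀ n i (p v : Map n i → Bool) → Extensional (λ σ → p σ ∧ v σ) →
                   sumOver v (listMaps n i p) ≡ sumMaps n i (λ σ → p σ ∧ v σ)
sumOver-listMaps n zero    p v ext = trans (sumOver-onlyIf v _ _) (ext _ _ (λ ()))
sumOver-listMaps n (suc i) p v ext =
  trans (sumOver-catFin v n _)
        (sum-cong n λ j → trans (sumOver-map v (j ∷_) (listMaps n i (p ∘ (j ∷_))))
                                (sumOver-listMaps n i (p ∘ (j ∷_)) (v ∘ (j ∷_)) (λ σ σ' eq → ext _ _ (∷-≗ j eq))))

supported⇒multi : ∀ {n i} (B : Subset n) (b : Tensor n i) → Extensional b →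
                  (∀ τ → b τ ≡ true → Admissible B τ) → MultiT i B b
supported⇒multi {n} {i} B b ext supp =
  listMaps n i b ,
  All.map (λ {σ} bσ → let (inj , into) = supp σ bσ in inj , true⇒∈ ∘ into) (All-listMaps n i b) ,
  λ τ → sym (begin
    sumList χ⊗ (listMaps n i b) τ                       ≡⟨ sumList-at χ⊗ (listMaps n i b) τ ⟩
    sumOver (λ σ → χ⊗ σ τ) (listMaps n i b)             ≡⟨ sumOver-listMaps n i b _ (δ-ext τ) ⟩
    sumMaps n i (λ σ → b σ ∧ prodFin i (λ h → σ h == τ h)) ≡⟨ sumMaps-delta n i b ext τ ⟩
    b τ                                                 ∎)
  where
  δ-ext : ∀ τ → Extensional (λ σ → b σ ∧ χ⊗ σ τ)
  δ-ext τ σ σ' eq = cong₂ _∧_ (ext σ σ' eq) (prod-cong i (λ h → cong (_== τ h) (eq h)))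

eval-basis : ∀ {n i} (b : Tensor n i) → Extensional b → (ρ : Map n i) → eval b (λ h → e (ρ h)) ≡ b ρ
eval-basis {n} {i} b ext ρ =
  trans (sumMaps-cong n i (λ τ → cong (b τ ∧_) (prod-cong i (λ h → ==-sym (ρ h) (τ h)))))
        (sumMaps-delta n i b ext ρ)

eval-symmetric : ∀ {n} (b : Tensor n 2) → Extensional b → (∀ j l → b (j ∷ l ∷ []) ≡ b (l ∷ j ∷ [])) →
                 ∀ σ₁ σ₂ → eval b (σ₁ ∷ σ₂ ∷ []) ≡ eval b (σ₂ ∷ σ₁ ∷ [])
eval-symmetric {n} b ext symmetric σ₁ σ₂ = begin
  eval b (σ₁ ∷ σ₂ ∷ [])
    ≡⟨ as-double-sum σ₁ σ₂ ⟩
  sumFin n (λ j → sumFin n (λ l → b (j ∷ l ∷ []) ∧ (σ₁ j ∧ (σ₂ l ∧ true))))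
    ≡⟨ sum-cong n (λ j → sum-cong n (λ l → cong₂ _∧_ (symmetric j l) (swap-factors (σ₁ j) (σ₂ l)))) ⟩
  sumFin n (λ j → sumFin n (λ l → b (l ∷ j ∷ []) ∧ (σ₂ l ∧ (σ₁ j ∧ true))))
    ≡⟨ sum-swap n n _ ⟩
  sumFin n (λ l → sumFin n (λ j → b (l ∷ j ∷ []) ∧ (σ₂ l ∧ (σ₁ j ∧ true))))
    ≡⟨ sym (as-double-sum σ₂ σ₁) ⟩
  eval b (σ₂ ∷ σ₁ ∷ []) ∎
  where
  as-double-sum : ∀ σ σ' → eval b (σ ∷ σ' ∷ []) ≡ sumFin n (λ j → sumFin n (λ l → b (j ∷ l ∷ []) ∧ (σ j ∧ (σ' l ∧ true))))
  as-double-sum σ σ' = sumMaps-cong n 2 {G = G} (λ τ → cong (_∧ _) (ext τ _ (λ { zero → refl ; (suc zero) → refl })))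
    where
    G : Map n 2 → Bool
    G τ = b (τ zero ∷ τ (suc zero) ∷ []) ∧ (σ (τ zero) ∧ (σ' (τ (suc zero)) ∧ true))
  swap-factors : ∀ x y → (x ∧ (y ∧ true)) ≡ (y ∧ (x ∧ true))
  swap-factors x y = trans (cong (x ∧_) (∧-identityʳ y))
                           (trans (∧-comm x y) (cong (y ∧_) (sym (∧-identityʳ x))))

Weight : ℕ → Set
Weight n = Subset n → Fin n → Bool

pairWeight : ∀ k {n} → Weight n → Map n (suc (suc k)) → Bool
pairWeight k w τ = w (image τ) (τ (penult k)) xor w (image τ) (τ (final k))

ImageFormWith : ∀ k {n} → Subset n → Weight n → Tensor n (suc (suc k)) → Set
ImageFormWith k B w b = ∀ τ → b τ ≡ (admissible B τ ∧ pairWeight k w τ)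

record ImageForm k {n} (B : Subset n) (b : Tensor n (suc (suc k))) : Set where
  constructor withWeight
  field
    weight  : Weight n
    formula : ImageFormWith k B weight b

imageForm-ext : ∀ k {n} {B : Subset n} {b : Tensor n (suc (suc k))} → ImageForm k B b → Extensional b
imageForm-ext k {B = B} (withWeight w form) τ τ' τ≗τ' = begin
  _ ≡⟨ form τ ⟩
  admissible B τ ∧ pairWeight k w τ
    ≡⟨ cong₂ _∧_ (admissible-cong B τ τ' τ≗τ')
                 (cong₂ _xor_ (cong₂ w (image-cong τ τ' τ≗τ') (τ≗τ' (penult k)))
                              (cong₂ w (image-cong τ τ' τ≗τ') (τ≗τ' (final k)))) ⟩
  admissible B τ' ∧ pairWeight k w τ' ≡⟨ sym (form τ') ⟩
  _ ∎

imageForm-supp : ∀ k {n} {B : Subset n} {b : Tensor n (suc (suc k))} → ImageForm k B b →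
                 ∀ τ → b τ ≡ true → Admissible B τ
imageForm-supp k {B = B} (withWeight w form) τ p = admissible⇒ B τ (∧-trueˡ (trans (sym (form τ)) p))

imageForm-inv : ∀ k {n} {B : Subset n} {b : Tensor n (suc (suc k))} → ImageForm k B b →
                ∀ τ τ' → admissible B τ ≡ admissible B τ' → image τ ≡ image τ' → LastSame k τ τ' → b τ ≡ b τ'
imageForm-inv k (withWeight w form) τ τ' adm≡ im≡ last =
  trans (form τ) (trans (cong₂ _∧_ adm≡ (pair≡ last)) (sym (form τ')))
  where
  pair≡ : LastSame k τ τ' → pairWeight k w τ ≡ pairWeight k w τ'
  pair≡ (inj₁ (p , q)) = cong₂ _xor_ (cong₂ w im≡ (sym p)) (cong₂ w im≡ (sym q))
  pair≡ (inj₂ (p , q)) = trans (xor-comm (w (image τ) (τ (penult k))) _)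
                               (cong₂ _xor_ (cong₂ w im≡ (sym p)) (cong₂ w im≡ (sym q)))

imageForm-zero : ∀ k {n} (B : Subset n) → ImageFormWith k B (λ _ _ → false) zeroT
imageForm-zero k B τ = sym (∧-zeroʳ (admissible B τ))

imageForm-⊕ : ∀ k {n} (B : Subset n) {w w' : Weight n} {b b' : Tensor n (suc (suc k))} →
              ImageFormWith k B w b → ImageFormWith k B w' b' →
              ImageFormWith k B (λ S y → w S y xor w' S y) (b ⊕ b')
imageForm-⊕ k B {w} {w'} form form' τ =
  trans (cong₂ _xor_ (form τ) (form' τ))
        (trans (sym (∧-distribˡ-xor (admissible B τ) _ _))
               (cong (admissible B τ ∧_) (interchange (w S p) (w S f) (w' S p) (w' S f))))
  where
  S = image τ
  p = τ (penult k)
  f = τ (final k)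

imageForm-unique : ∀ k {n} (B : Subset n) {w w' : Weight n} {b b' : Tensor n (suc (suc k))} →
                   (∀ τ → Admissible B τ → pairWeight k w τ ≡ pairWeight k w' τ) →
                   ImageFormWith k B w b → ImageFormWith k B w' b' → b ≈ b'
imageForm-unique k B agree form form' τ with admissible B τ in adm
... | false = trans (form τ) (trans (cong (_∧ _) adm) (sym (trans (form' τ) (cong (_∧ _) adm))))
... | true  = trans (form τ) (trans (cong₂ _∧_ adm (agree τ (admissible⇒ B τ adm)))
                                    (sym (trans (form' τ) (cong (_∧ _) adm))))

imageForm⇒multi : ∀ k {n} {B : Subset n} {b : Tensor n (suc (suc k))} → ImageForm k B b → MultiT (suc (suc k)) B b
imageForm⇒multi k {B = B} {b} form = supported⇒multi B b (imageForm-ext k form) (imageForm-supp k form)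

isBijOnto-image : ∀ {n i} (A : Subset n) (τ : Map n i) → isBijOnto A τ ≡ (injB τ ∧ does (image τ ≟ₛ A))
isBijOnto-image {n} {i} A τ = cong (injB τ ∧_) (bool-ext onto⇒image image⇒onto)
  where
  into-A = prodFin i (λ h → lookup A (τ h))
  covers-A = prodFin n (λ a → not (lookup A a) ∨ anyFin i (λ h → τ h == a))
  onto⇒image : (into-A ∧ covers-A) ≡ true → does (image τ ≟ₛ A) ≡ true
  onto⇒image p = dec-true (image τ ≟ₛ A) (trans (VP.tabulate-cong pointwise) (VP.tabulate∘lookup A))
    where
    pointwise : ∀ a → anyFin i (λ h → τ h == a) ≡ lookup A a
    pointwise a = bool-ext
      (λ q → let (l , r) = any-true i _ q in
             subst (λ z → lookup A z ≡ true) (==⇒≡ r) (prod-true i _ (∧-trueˡ p) l))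
      (λ q → ∨-trueʳ (prod-true n _ (∧-trueʳ {into-A} p) a) (cong not q))
  image⇒onto : does (image τ ≟ₛ A) ≡ true → (into-A ∧ covers-A) ≡ true
  image⇒onto p = ∧-true (true-prod i _ λ h → subst (λ S → lookup S (τ h) ≡ true) im≡A (true-image τ h))
                        (true-prod n _ covered)
    where
    im≡A = does⇒ (image τ ≟ₛ A) p
    covered : ∀ a → (not (lookup A a) ∨ anyFin i (λ h → τ h == a)) ≡ true
    covered a with lookup A a in a∈A
    ... | false = refl
    ... | true  = trans (sym (VP.lookup∘tabulate _ a)) (trans (cong (λ S → lookup S a) im≡A) a∈A)

isBijOnto-cong : ∀ {n i} (A : Subset n) → Extensional (isBijOnto {n} {i} A)
isBijOnto-cong A τ τ' τ≗τ' =
  trans (isBijOnto-image A τ)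
        (trans (cong₂ (λ I S → I ∧ does (S ≟ₛ A)) (injB-cong τ τ' τ≗τ') (image-cong τ τ' τ≗τ'))
               (sym (isBijOnto-image A τ')))

φ-value : ∀ k {n} (A : Subset n) (x : Fin n) (ρ : Map n (suc (suc k))) →
          φ (suc (suc k)) A x ρ ≡ (isBijOnto A ρ ∧ ((ρ (penult k) == x) ∨ (ρ (final k) == x)))
φ-value k {n} A x ρ = sumMaps-delta n (suc (suc k)) _ on-last-two ρ
  where
  on-last-two : Extensional (λ τ → isBijOnto A τ ∧ ((τ (penult k) == x) ∨ (τ (final k) == x)))
  on-last-two τ τ' τ≗τ' =
    cong₂ _∧_ (isBijOnto-cong A τ τ' τ≗τ')
              (cong₂ _∨_ (cong (_== x) (τ≗τ' _)) (cong (_== x) (τ≗τ' _)))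

point : ∀ {n} → Subset n → Fin n → Weight n
point A x S y = does (S ≟ₛ A) ∧ (x == y)

-- Truth-table identity behind φ-imageForm, with I = [τ injective],
-- E = [im τ = A], T = [τ into B], a = [τ_{k+1} = x], b = [τ_{k+2} = x].
φ-shape : ∀ I E T a b → (I ≡ true → E ≡ true → T ≡ true) → (I ≡ true → a ≡ true → b ≡ true → ⊥) →
          ((I ∧ E) ∧ (a ∨ b)) ≡ ((I ∧ T) ∧ ((E ∧ a) xor (E ∧ b)))
φ-shape false E     T     a     b     _     _        = refl
φ-shape true  false T     a     b     _     _        = sym (∧-zeroʳ T)
φ-shape true  true  false a     b     inB   _        = ⊥-elim (true≢false (sym (inB refl refl)))
φ-shape true  true  true  true  true  _     distinct = ⊥-elim (distinct refl refl refl)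
φ-shape true  true  true  true  false _     _        = refl
φ-shape true  true  true  false true  _     _        = refl
φ-shape true  true  true  false false _     _        = refl

φ-imageForm : ∀ k {n} (B A : Subset n) (x : Fin n) → A ⊆ B →
              ImageFormWith k B (point A x) (φ (suc (suc k)) A x)
φ-imageForm k B A x A⊆B τ = begin
  φ (suc (suc k)) A x τ
    ≡⟨ trans (φ-value k A x τ) (cong (_∧ _) (isBijOnto-image A τ)) ⟩
  (injB τ ∧ E) ∧ ((p == x) ∨ (f == x))
    ≡⟨ cong (λ z → (injB τ ∧ E) ∧ z) (cong₂ _∨_ (==-sym p x) (==-sym f x)) ⟩
  (injB τ ∧ E) ∧ ((x == p) ∨ (x == f))
    ≡⟨ φ-shape (injB τ) E (intoB B τ) (x == p) (x == f) into-B distinct ⟩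
  admissible B τ ∧ pairWeight k (point A x) τ ∎
  where
  E = does (image τ ≟ₛ A)
  p = τ (penult k)
  f = τ (final k)
  into-B : injB τ ≡ true → E ≡ true → intoB B τ ≡ true
  into-B _ e = true-prod _ _ λ h →
    ∈⇒true (A⊆B (true⇒∈ (subst (λ S → lookup S (τ h) ≡ true) (does⇒ (image τ ≟ₛ A) e) (true-image τ h))))
  distinct : injB τ ≡ true → (x == p) ≡ true → (x == f) ≡ true → ⊥
  distinct inj x≡p x≡f = penult≢final k (injB-true τ inj _ _ (trans (sym (==⇒≡ {x = x} x≡p)) (==⇒≡ {x = x} x≡f)))

govWeight : ∀ {n} → List (GovIx n) → Weight n
govWeight as S y = sumOver (λ p → point (proj₁ p) (proj₂ p) S y) as

governing : ∀ k {n} → GovIx n → Tensor n (suc (suc k))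
governing k (A , x) = φ (suc (suc k)) A x

sumList-imageForm : ∀ k {n} (B : Subset n) (as : List (GovIx n)) → All (GovOK (suc (suc k)) B) as →
                    ImageFormWith k B (govWeight as) (sumList (governing k) as)
sumList-imageForm k B []ₗ             []ᵃ                 = imageForm-zero k B
sumList-imageForm k B ((A , x) ∷ₗ as) ((A⊆B , _) ∷ᵃ oks) =
  imageForm-⊕ k B {point A x} {govWeight as} (φ-imageForm k B A x A⊆B) (sumList-imageForm k B as oks)

gov⇒imageForm : ∀ k {n} {B : Subset n} {b : Tensor n (suc (suc k))} → Gov (suc (suc k)) B b → ImageForm k B b
gov⇒imageForm k {B = B} (as , oks , b≈) =
  withWeight (govWeight as) (λ τ → trans (b≈ τ) (sumList-imageForm k B as oks τ))

-- Conversely a tensor of image form over B is the sum of the governing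
-- tensors φ_(A,x) over the pairs with A ⊆ B, |A| = k + 2, x ∈ A at which
-- its weight is 1.  Only the weight of that sum needs to be computed.

governingPair : ∀ k {n} → Subset n → Subset n → Fin n → Bool
governingPair k B A x = does (A ⊆? B) ∧ (does (∣ A ∣ ℕ.≟ suc (suc k)) ∧ does (x ∈? A))

governingPair-ok : ∀ k {n} (B A : Subset n) x → governingPair k B A x ≡ true → GovOK (suc (suc k)) B (A , x)
governingPair-ok k B A x p =
  does⇒ (A ⊆? B) (∧-trueˡ p) ,
  does⇒ (∣ A ∣ ℕ.≟ suc (suc k)) (∧-trueˡ (∧-trueʳ {does (A ⊆? B)} p)) ,
  does⇒ (x ∈? A) (∧-trueʳ {does (∣ A ∣ ℕ.≟ suc (suc k))} (∧-trueʳ {does (A ⊆? B)} p))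

governingList : ∀ k {n} → Subset n → Weight n → List (GovIx n)
governingList k {n} B w = catSub n λ A → catFin n λ x → onlyIf (governingPair k B A x ∧ w A x) (A , x)

governingList-ok : ∀ k {n} (B : Subset n) w → All (GovOK (suc (suc k)) B) (governingList k B w)
governingList-ok k {n} B w = All-catSub n _ λ A → All-catFin n _ λ x →
  All-onlyIf _ (A , x) (governingPair-ok k B A x ∘ ∧-trueˡ)

governingList-weight : ∀ k {n} (B : Subset n) w S y →
                       govWeight (governingList k B w) S y ≡ (governingPair k B S y ∧ w S y)
governingList-weight k {n} B w S y = begin
  govWeight (governingList k B w) S y
    ≡⟨ sumOver-catSub v n _ ⟩
  sumSub n (λ A → sumOver v (catFin n (λ x → onlyIf (c A x) (A , x))))
    ≡⟨ sumSub-cong n (λ A → trans (sumOver-catFin v n _) (sum-cong n (λ x → sumOver-onlyIf v (c A x) (A , x)))) ⟩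
  sumSub n (λ A → sumFin n (λ x → c A x ∧ (does (S ≟ₛ A) ∧ (x == y))))
    ≡⟨ sumSub-cong n (λ A → trans (sum-cong n (λ x → rearrange (c A x) (does (S ≟ₛ A)) (x == y)))
                                  (sum-scale n (does (S ≟ₛ A)) _)) ⟩
  sumSub n (λ A → does (S ≟ₛ A) ∧ sumFin n (λ x → (x == y) ∧ c A x))
    ≡⟨ sumSub-cong n (λ A → cong (does (S ≟ₛ A) ∧_) (sum-delta n y (c A))) ⟩
  sumSub n (λ A → does (S ≟ₛ A) ∧ c A y)
    ≡⟨ sumSub-delta n S (λ A → c A y) ⟩
  c S y ∎
  where
  c : Subset n → Fin n → Bool
  c A x = governingPair k B A x ∧ w A x
  v : GovIx n → Bool
  v p = point (proj₁ p) (proj₂ p) S y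
  rearrange : ∀ a e d → (a ∧ (e ∧ d)) ≡ (e ∧ (d ∧ a))
  rearrange a e d = trans (∧-comm a (e ∧ d)) (∧-assoc e d a)

image-card : ∀ {n} i (τ : Map n i) → Injective τ → ∣ image τ ∣ ≡ i
image-card {n} zero    τ inj = card-empty n
  where
  card-empty : ∀ m → ∣ tabulate {n = m} (λ _ → false) ∣ ≡ 0
  card-empty zero    = refl
  card-empty (suc m) = card-empty m
image-card {n} (suc i) τ inj =
  trans (card-insert n _ (τ zero) head∉tail)
        (cong suc (image-card i (τ ∘ suc) (λ h h' eq → FP.suc-injective (inj _ _ eq))))
  where
  head∉tail : anyFin i (λ l → τ (suc l) == τ zero) ≡ false
  head∉tail = ≢true⇒≡false λ q → let (l , r) = any-true i _ q in zero≢suc (inj _ _ (sym (==⇒≡ r)))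
    where zero≢suc : ∀ {m} {x : Fin m} → zero ≢ suc x
          zero≢suc ()
  card-insert : ∀ m (f : Fin m → Bool) j → f j ≡ false →
                ∣ tabulate (λ a → (j == a) ∨ f a) ∣ ≡ suc ∣ tabulate f ∣
  card-insert (suc m) f zero    fj rewrite fj = refl
  card-insert (suc m) f (suc j) fj with f zero
  ... | true  = cong suc (card-insert m (f ∘ suc) j fj)
  ... | false = card-insert m (f ∘ suc) j fj

admissible-governingPair : ∀ k {n} (B : Subset n) (τ : Map n (suc (suc k))) → Admissible B τ → ∀ l →
                           governingPair k B (image τ) (τ l) ≡ true
admissible-governingPair k B τ (inj , into) l =
  ∧-true (dec-true (image τ ⊆? B) image⊆B)
         (∧-true (dec-true (∣ image τ ∣ ℕ.≟ suc (suc k)) (image-card (suc (suc k)) τ inj))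
                 (dec-true (τ l ∈? image τ) (true⇒∈ (true-image τ l))))
  where
  image⊆B : image τ ⊆ B
  image⊆B {a} a∈im = let (l′ , r) = image-true τ a (∈⇒true a∈im) in true⇒∈ (subst (λ z → lookup B z ≡ true) r (into l′))

imageForm⇒gov : ∀ k {n} {B : Subset n} {b : Tensor n (suc (suc k))} → ImageForm k B b → Gov (suc (suc k)) B b
imageForm⇒gov k {B = B} (withWeight w form) =
  governingList k B w , governingList-ok k B w ,
  imageForm-unique k B {w} {govWeight (governingList k B w)} agree form (sumList-imageForm k B _ (governingList-ok k B w))
  where
  agree : ∀ τ → Admissible B τ → pairWeight k w τ ≡ pairWeight k (govWeight (governingList k B w)) τ
  agree τ adm = sym (cong₂ _xor_ (at (penult k)) (at (final k)))
    where
    at : ∀ l → govWeight (governingList k B w) (image τ) (τ l) ≡ w (image τ) (τ l)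
    at l = trans (governingList-weight k B w (image τ) (τ l))
                 (cong (_∧ w (image τ) (τ l)) (admissible-governingPair k B τ adm l))

imageForm-swap : ∀ k {n} {B : Subset n} {b : Tensor n (suc (suc k))} → ImageForm k B b →
                 ∀ u v τ → LastSame k τ (swapAt u v τ) → b τ ≡ b (swapAt u v τ)
imageForm-swap k {B = B} form u v τ =
  imageForm-inv k form τ _ (sym (admissible-swap B u v τ)) (sym (image-swap u v τ))

insert : ∀ {n} → Fin n → Subset n → Subset n
insert j S = tabulate (λ a → (j == a) ∨ lookup S a)

image-∷ : ∀ {n i} (j : Fin n) (τ : Map n i) → image (j ∷ τ) ≡ insert j (image τ)
image-∷ j τ = VP.tabulate-cong (λ a → cong ((j == a) ∨_) (sym (VP.lookup∘tabulate _ a)))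

imageForm-slice : ∀ k {n} {B : Subset n} {b : Tensor n (suc (suc (suc k)))} → ImageForm (suc k) B b →
                  ∀ j → lookup B j ≡ true → ImageForm k (B - j) (b ·e j)
imageForm-slice k {B = B} (withWeight w form) j j∈B = withWeight (λ S → w (insert j S)) λ τ →
  trans (form (j ∷ τ))
        (cong₂ _∧_ (admissible-∷ B j τ j∈B)
                   (cong₂ _xor_ (cong (λ S → w S (τ (penult k))) (image-∷ j τ))
                                (cong (λ S → w S (τ (final k))) (image-∷ j τ))))

imageForm-symmetric : ∀ {n} {B : Subset n} {b : Tensor n 2} → ImageForm 0 B b →
                      ∀ j l → b (j ∷ l ∷ []) ≡ b (l ∷ j ∷ [])
imageForm-symmetric form j l =
  trans (imageForm-swap 0 form zero (suc zero) (j ∷ l ∷ []) (inj₂ (refl , refl)))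
        (imageForm-ext 0 form _ _ (λ { zero → refl ; (suc zero) → refl }))

-- Order 3: the cyclic sum vanishes, since all three terms are read off at
-- the same image and the three weights cancel in pairs.
imageForm-cyclic : ∀ {n} {B : Subset n} {b : Tensor n 3} → ImageForm 1 B b → ∀ j₁ j₂ j₃ →
                   (b (j₁ ∷ j₂ ∷ j₃ ∷ []) xor b (j₃ ∷ j₁ ∷ j₂ ∷ []) xor b (j₂ ∷ j₃ ∷ j₁ ∷ [])) ≡ false
imageForm-cyclic {B = B} {b} (withWeight w form) j₁ j₂ j₃ = begin
  b τ xor b (j₃ ∷ j₁ ∷ j₂ ∷ []) xor b (j₂ ∷ j₃ ∷ j₁ ∷ [])
    ≡⟨ cong₂ _xor_ (form τ) (cong₂ _xor_ (trans (ext _ _ (λ { zero → refl ; (suc zero) → refl ; (suc (suc zero)) → refl }))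
                                                (twice-swapped (suc zero) (suc (suc zero))))
                                         (trans (ext _ _ (λ { zero → refl ; (suc zero) → refl ; (suc (suc zero)) → refl }))
                                                (twice-swapped zero (suc zero)))) ⟩
  (O ∧ (w S j₂ xor w S j₃)) xor (O ∧ (w S j₁ xor w S j₂)) xor (O ∧ (w S j₃ xor w S j₁))
    ≡⟨ cyclic-shape O (w S j₁) (w S j₂) (w S j₃) ⟩
  false ∎
  where
  τ = j₁ ∷ j₂ ∷ j₃ ∷ []
  O = admissible B τ
  S = image τ
  ext = imageForm-ext 1 {B = B} (withWeight w form)
  once : Map _ 3
  once = swapAt zero (suc (suc zero)) τ
  twice : Fin 3 → Fin 3 → Map _ 3
  twice u v = swapAt u v once
  twice-swapped : ∀ u v → b (twice u v) ≡ (O ∧ (w S (twice u v (penult 1)) xor w S (twice u v (final 1))))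
  twice-swapped u v = trans (form (twice u v))
    (cong₂ (λ O′ S′ → O′ ∧ (w S′ (twice u v (penult 1)) xor w S′ (twice u v (final 1))))
           (trans (admissible-swap B u v once) (admissible-swap B zero (suc (suc zero)) τ))
           (trans (image-swap u v once) (image-swap zero (suc (suc zero)) τ)))
  cyclic-shape : ∀ O a₁ a₂ a₃ → ((O ∧ (a₂ xor a₃)) xor (O ∧ (a₁ xor a₂)) xor (O ∧ (a₃ xor a₁))) ≡ false
  cyclic-shape false _     _     _     = refl
  cyclic-shape true  true  true  true  = refl
  cyclic-shape true  true  true  false = refl
  cyclic-shape true  true  false true  = refl
  cyclic-shape true  true  false false = refl
  cyclic-shape true  false true  true  = refl
  cyclic-shape true  false true  false = refl
  cyclic-shape true  false false true  = refl
  cyclic-shape true  false false false = refl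

imageForm-front : ∀ k {n} {B : Subset n} {b : Tensor n (suc (suc (suc (suc k))))} → ImageForm (suc (suc k)) B b →
                  ∀ j₁ j₂ τ → b (j₁ ∷ j₂ ∷ τ) ≡ b (j₂ ∷ j₁ ∷ τ)
imageForm-front k form j₁ j₂ τ =
  trans (imageForm-swap (suc (suc k)) form zero (suc zero) (j₁ ∷ j₂ ∷ τ) (inj₁ (refl , refl)))
        (imageForm-ext (suc (suc k)) form _ _ (λ { zero → refl ; (suc zero) → refl ; (suc (suc h)) → refl }))

imageForm⇒cons : ∀ k {n} {B : Subset n} {b : Tensor n (suc (suc k))} → ImageForm k B b → Cons (suc (suc k)) B b
imageForm⇒cons zero {B = B} {b} form =
  imageForm⇒multi 0 form ,
  eval-symmetric b (imageForm-ext 0 form) (imageForm-symmetric form)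
imageForm⇒cons (suc zero) {B = B} {b} form =
  imageForm⇒multi 1 form ,
  (λ j j∈B → imageForm⇒cons 0 (imageForm-slice 0 form j (∈⇒true j∈B))) ,
  λ j₁ j₂ j₃ → trans (cong₂ _xor_ (at (j₁ ∷ j₂ ∷ j₃ ∷ [])) (cong₂ _xor_ (at (j₃ ∷ j₁ ∷ j₂ ∷ [])) (at (j₂ ∷ j₃ ∷ j₁ ∷ []))))
                     (imageForm-cyclic form j₁ j₂ j₃)
  where
  at : ∀ ρ → eval b (λ h → e (ρ h)) ≡ b ρ
  at = eval-basis b (imageForm-ext 1 form)
imageForm⇒cons (suc (suc k)) form =
  imageForm⇒multi (suc (suc k)) form ,
  (λ j j∈B → imageForm⇒cons (suc k) (imageForm-slice (suc k) form j (∈⇒true j∈B))) ,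
  (λ j₁ j₂ _ _ _ τ → imageForm-front k form j₁ j₂ τ)

cons-multi : ∀ k {n} {B : Subset n} {b : Tensor n (suc (suc k))} → Cons (suc (suc k)) B b → MultiT (suc (suc k)) B b
cons-multi zero          c = proj₁ c
cons-multi (suc zero)    c = proj₁ c
cons-multi (suc (suc k)) c = proj₁ c

cons-ext : ∀ k {n} {B : Subset n} {b : Tensor n (suc (suc k))} → Cons (suc (suc k)) B b → Extensional b
cons-ext k c = multi-ext (cons-multi k c)

cons-slice : ∀ k {n} {B : Subset n} {b : Tensor n (suc (suc (suc k)))} → Cons (suc (suc (suc k))) B b →
             ∀ j → lookup B j ≡ true → Cons (suc (suc k)) (B - j) (b ·e j)
cons-slice zero    c j j∈B = proj₁ (proj₂ c) j (true⇒∈ j∈B)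
cons-slice (suc k) c j j∈B = proj₁ (proj₂ c) j (true⇒∈ j∈B)

cons-symmetric : ∀ {n} {B : Subset n} {b : Tensor n 2} → Cons 2 B b → ∀ p q → b (p ∷ q ∷ []) ≡ b (q ∷ p ∷ [])
cons-symmetric {b = b} c p q =
  trans (sym (eval-basis b ext (p ∷ q ∷ []))) (trans (proj₂ c (e p) (e q)) (eval-basis b ext (q ∷ p ∷ [])))
  where ext = cons-ext 0 c

Invariant : ∀ k {n} → Subset n → Tensor n (suc (suc k)) → Set
Invariant k B b = ∀ τ τ' → Admissible B τ → Admissible B τ' → image τ ≡ image τ' → LastSame k τ τ' → b τ ≡ b τ'

invariant₂ : ∀ {n} {B : Subset n} {b : Tensor n 2} → Cons 2 B b → Invariant 0 B b
invariant₂ c τ τ' _ _ _ (inj₁ (p , q)) = cons-ext 0 c τ τ' λ { zero → sym p ; (suc zero) → sym q }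
invariant₂ c τ τ' _ _ _ (inj₂ (p , q)) =
  trans (cons-ext 0 c τ _ (λ { zero → refl ; (suc zero) → refl }))
        (trans (cons-symmetric c (τ zero) (τ (suc zero)))
               (cons-ext 0 c _ τ' (λ { zero → sym p ; (suc zero) → sym q })))

-- Tuples with the same first entry j are compared in the slice b(e_j, -).
same-head : ∀ k {n} {B : Subset n} {b : Tensor n (suc (suc (suc k)))} → Cons (suc (suc (suc k))) B b →
            (∀ j → lookup B j ≡ true → Invariant k (B - j) (b ·e j)) →
            ∀ τ τ' → Admissible B τ → Admissible B τ' → image τ ≡ image τ' → LastSame (suc k) τ τ' →
            τ zero ≡ τ' zero → b τ ≡ b τ'
same-head k {B = B} {b} c slices τ τ' adm adm' im≡ last head≡ = begin
  b τ                       ≡⟨ ext τ _ (sym ∘ head∷tail τ) ⟩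
  (b ·e τ zero) (τ ∘ suc)    ≡⟨ slices (τ zero) (proj₂ adm zero) (τ ∘ suc) (τ' ∘ suc)
                                  (tail-admissible B τ adm) tail-adm′
                                  (tail-image τ τ' (proj₁ adm) (proj₁ adm') head≡ im≡) last ⟩
  (b ·e τ zero) (τ' ∘ suc)   ≡⟨ ext _ τ' (λ { zero → head≡ ; (suc h) → refl }) ⟩
  b τ'                      ∎
  where
  ext = cons-ext (suc k) c
  tail-adm′ : Admissible (B - τ zero) (τ' ∘ suc)
  tail-adm′ = subst (λ j → Admissible (B - j) (τ' ∘ suc)) (sym head≡) (tail-admissible B τ' adm')

head-not-last : ∀ k {n} (τ τ' : Map n (suc (suc (suc k)))) → Injective τ' → LastSame (suc k) τ τ' →
                ∀ l → τ l ≡ τ' zero → (l ≢ penult (suc k)) × (l ≢ final (suc k))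
head-not-last k τ τ' inj' last l τl≡ = not-penult last , not-final last
  where
  not-penult : LastSame (suc k) τ τ' → l ≢ penult (suc k)
  not-penult (inj₁ (p , _)) refl with inj' _ _ (sym (trans p τl≡))
  ... | ()
  not-penult (inj₂ (_ , q)) refl with inj' _ _ (sym (trans q τl≡))
  ... | ()
  not-final : LastSame (suc k) τ τ' → l ≢ final (suc k)
  not-final (inj₁ (_ , q)) refl with inj' _ _ (sym (trans q τl≡))
  ... | ()
  not-final (inj₂ (p , _)) refl with inj' _ _ (sym (trans p τl≡))
  ... | ()

-- From order 4 on, the entry of τ equal to τ'(0) is moved to the front in
-- two steps: exchange it with the entry at position 1 (same head), then
-- exchange the first two entries (allowed by consistency).
front-swap : ∀ k {n} {B : Subset n} {b : Tensor n (suc (suc (suc (suc k))))} → Cons (suc (suc (suc (suc k)))) B b →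
             (∀ j → lookup B j ≡ true → Invariant (suc k) (B - j) (b ·e j)) →
             ∀ τ τ' → Admissible B τ → Admissible B τ' → image τ ≡ image τ' → LastSame (suc (suc k)) τ τ' →
             ∀ l → τ l ≡ τ' zero → l ≢ zero → l ≢ penult (suc (suc k)) → l ≢ final (suc (suc k)) → b τ ≡ b τ'
front-swap k {B = B} {b} c slices τ τ' adm adm' im≡ last l τl≡ l≢0 l≢p l≢f =
  trans (same-head (suc k) c slices τ σ adm adm-σ (sym (image-swap (suc zero) l τ)) last-σ (sym σ0))
        (trans exchange-front
               (same-head (suc k) c slices π τ' adm-π adm' im-π last-π (trans π0 τl≡)))
  where
  K = suc (suc k)
  σ = swapAt (suc zero) l τ
  π = swapAt zero (suc zero) σ
  adm-σ = swap-admissible B _ _ τ adm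
  adm-π = swap-admissible B _ _ σ adm-σ
  σ0 : σ zero ≡ τ zero
  σ0 = cong τ (swapIx-other (suc zero) l zero (λ ()) (l≢0 ∘ sym))
  π0 : π zero ≡ τ l
  π0 = trans (cong σ (swapIx-u zero (suc zero))) (cong τ (swapIx-u (suc zero) l))
  last-σ : LastSame K τ σ
  last-σ = inj₁ (cong τ (swapIx-other (suc zero) l (penult K) (λ ()) (l≢p ∘ sym)) ,
                 cong τ (swapIx-other (suc zero) l (final K) (λ ()) (l≢f ∘ sym)))
  last-π : LastSame K π τ'
  last-π = lastSame-trans K {τ = π} {σ} {τ'} (inj₁ (sym (cong σ (swapIx-other zero (suc zero) (penult K) (λ ()) (λ ()))) ,
                                   sym (cong σ (swapIx-other zero (suc zero) (final K) (λ ()) (λ ())))))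
                            (lastSame-trans K {τ = σ} {τ} {τ'} (lastSame-sym K {τ = τ} {σ} last-σ) last)
  im-π : image π ≡ image τ'
  im-π = trans (image-swap zero (suc zero) σ) (trans (image-swap (suc zero) l τ) im≡)
  exchange-front : b σ ≡ b π
  exchange-front =
    trans (cons-ext K c σ _ (λ { zero → refl ; (suc zero) → refl ; (suc (suc h)) → refl }))
          (trans (proj₂ (proj₂ c) (σ zero) (σ (suc zero)) (true⇒∈ (proj₂ adm-σ zero)) (true⇒∈ (proj₂ adm-σ (suc zero)))
                                  (λ eq → case-absurd (proj₁ adm-σ zero (suc zero) eq)) (λ h → σ (suc (suc h))))
                 (cons-ext K c _ π (λ { zero → sym (cong σ (swapIx-u zero (suc zero)))
                                      ; (suc zero) → sym (cong σ (swapIx-v zero (suc zero)))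
                                      ; (suc (suc h)) → sym (cong σ (swapIx-other zero (suc zero) (suc (suc h)) (λ ()) (λ ()))) })))
    where
    case-absurd : zero ≡ suc zero → ⊥
    case-absurd ()

-- Write τ'(0) = τ(l): for l = 0 compare in the
-- slice; otherwise l is not one of the last two positions, which cannot
-- happen in order 3 and is handled by front-swap from order 4 on.
cons-invariant : ∀ k {n} {B : Subset n} {b : Tensor n (suc (suc k))} → Cons (suc (suc k)) B b → Invariant k B b
cons-invariant zero c = invariant₂ c
cons-invariant (suc k) c τ τ' adm adm' im≡ last with image-≡⇒ τ' τ (sym im≡) zero
... | zero , τ0≡ = same-head k c slices τ τ' adm adm' im≡ last τ0≡
  where slices = λ j j∈B → cons-invariant k (cons-slice k c j j∈B)
... | suc l , τl≡ = head-moved k c τ τ' adm adm' im≡ last l τl≡ (head-not-last k τ τ' (proj₁ adm') last (suc l) τl≡)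
  where
  head-moved : ∀ k {n} {B : Subset n} {b : Tensor n (suc (suc (suc k)))} → Cons (suc (suc (suc k))) B b →
             ∀ τ τ' → Admissible B τ → Admissible B τ' → image τ ≡ image τ' → LastSame (suc k) τ τ' →
             ∀ l → τ (suc l) ≡ τ' zero → (suc l ≢ penult (suc k)) × (suc l ≢ final (suc k)) → b τ ≡ b τ'
  head-moved zero    c τ τ' _ _ _ _ zero       _ (not-p , _) = ⊥-elim (not-p refl)
  head-moved zero    c τ τ' _ _ _ _ (suc zero) _ (_ , not-f) = ⊥-elim (not-f refl)
  head-moved (suc k) c τ τ' adm adm' im≡ last l τl≡ (not-p , not-f) =
    front-swap k c (λ j j∈B → cons-invariant (suc k) (cons-slice (suc k) c j j∈B))
               τ τ' adm adm' im≡ last (suc l) τl≡ (λ ()) not-p not-f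

-- The cyclic shift (…, a, b, c) ↦ (…, c, a, b) of the last three entries.
rotate : ∀ {n} k → Map n (suc (suc (suc k))) → Map n (suc (suc (suc k)))
rotate k τ = swapAt (penult (suc k)) (final (suc k)) (swapAt (antepenult k) (final (suc k)) τ)

rotate-≗ : ∀ {n} k {τ τ' : Map n (suc (suc (suc k)))} → τ ≗ τ' → rotate k τ ≗ rotate k τ'
rotate-≗ k τ≗τ' = swap-≗ (penult (suc k)) (final (suc k)) (swap-≗ (antepenult k) (final (suc k)) τ≗τ')

rotate-suc : ∀ {n} k (τ : Map n (suc (suc (suc (suc k))))) → rotate (suc k) τ ≗ (τ zero ∷ rotate k (τ ∘ suc))
rotate-suc k τ h =
  trans (swap-≗ (penult (suc (suc k))) (final (suc (suc k))) (swap-suc (antepenult k) (final (suc k)) τ) h)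
        (swap-suc (penult (suc k)) (final (suc k)) (τ zero ∷ swapAt (antepenult k) (final (suc k)) (τ ∘ suc)) h)

rotate²-suc : ∀ {n} k (τ : Map n (suc (suc (suc (suc k))))) →
              rotate (suc k) (rotate (suc k) τ) ≗ (τ zero ∷ rotate k (rotate k (τ ∘ suc)))
rotate²-suc k τ h =
  trans (rotate-suc k (rotate (suc k) τ) h)
        (∷-≗ (τ zero) (rotate-≗ k (rotate-suc k τ ∘ suc)) h)

rotate-penult : ∀ {n} k (τ : Map n (suc (suc (suc k)))) → rotate k τ (penult (suc k)) ≡ τ (antepenult k)
rotate-penult k τ = trans (cong (swapAt (antepenult k) (final (suc k)) τ) (swapIx-u (penult (suc k)) (final (suc k))))
                          (cong τ (swapIx-v (antepenult k) (final (suc k))))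

rotate-final : ∀ {n} k (τ : Map n (suc (suc (suc k)))) → rotate k τ (final (suc k)) ≡ τ (penult (suc k))
rotate-final k τ =
  trans (cong (swapAt (antepenult k) (final (suc k)) τ) (swapIx-v (penult (suc k)) (final (suc k))))
        (cong τ (swapIx-other (antepenult k) (final (suc k)) (penult (suc k)) (antepenult≢penult k ∘ sym) (penult≢final (suc k))))

rotate-antepenult : ∀ {n} k (τ : Map n (suc (suc (suc k)))) → rotate k τ (antepenult k) ≡ τ (final (suc k))
rotate-antepenult k τ =
  trans (cong (swapAt (antepenult k) (final (suc k)) τ) (swapIx-other (penult (suc k)) (final (suc k)) (antepenult k) (antepenult≢penult k) (antepenult≢final k)))
        (cong τ (swapIx-u (antepenult k) (final (suc k))))

rotate-admissible : ∀ {n} k (B : Subset n) τ → Admissible B τ → Admissible B (rotate k τ)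
rotate-admissible k B τ adm =
  swap-admissible B (penult (suc k)) (final (suc k)) _ (swap-admissible B (antepenult k) (final (suc k)) τ adm)

image-rotate : ∀ {n} k (τ : Map n (suc (suc (suc k)))) → image (rotate k τ) ≡ image τ
image-rotate k τ = trans (image-swap (penult (suc k)) (final (suc k)) (swapAt (antepenult k) (final (suc k)) τ))
                         (image-swap (antepenult k) (final (suc k)) τ)

Cyclic : ∀ k {n} → Subset n → Tensor n (suc (suc (suc k))) → Set
Cyclic k B b = ∀ τ → (b τ xor b (rotate k τ) xor b (rotate k (rotate k τ))) ≡ false

-- In order 3 this is the defining cyclic condition; in higher orders the
-- relation follows from the one for the slice at the first entry (and is
-- trivial when that entry lies outside B).
cons-cyclic : ∀ k {n} {B : Subset n} {b : Tensor n (suc (suc (suc k)))} → Cons (suc (suc (suc k))) B b → Cyclic k B b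
cons-cyclic zero {b = b} c τ =
  trans (cong₂ _xor_ (ext τ _ three)
          (cong₂ _xor_ (ext (rotate 0 τ) _ three) (ext (rotate 0 (rotate 0 τ)) _ three)))
  (trans (cong₂ _xor_ (sym (at (τ zero ∷ τ (suc zero) ∷ τ (suc (suc zero)) ∷ [])))
           (cong₂ _xor_ (sym (at (τ (suc (suc zero)) ∷ τ zero ∷ τ (suc zero) ∷ [])))
                        (sym (at (τ (suc zero) ∷ τ (suc (suc zero)) ∷ τ zero ∷ [])))))
         (proj₂ (proj₂ c) (τ zero) (τ (suc zero)) (τ (suc (suc zero)))))
  where
  ext = cons-ext 1 c
  at = eval-basis b ext
  three : ∀ {σ : Map _ 3} → σ ≗ (σ zero ∷ σ (suc zero) ∷ σ (suc (suc zero)) ∷ [])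
  three {σ} = λ { zero → refl ; (suc zero) → refl ; (suc (suc zero)) → refl }
cons-cyclic (suc k) {B = B} {b} c τ with lookup B (τ zero) in τ0∈B
... | true  =
  trans (cong₂ _xor_ (ext τ _ (sym ∘ head∷tail τ))
          (cong₂ _xor_ (ext (rotate (suc k) τ) _ (rotate-suc k τ)) (ext _ _ (rotate²-suc k τ))))
        (cons-cyclic k (cons-slice (suc k) c (τ zero) τ0∈B) (τ ∘ suc))
  where ext = cons-ext (suc (suc k)) c
... | false = cong₂ _xor_ (vanishes τ refl)
                (cong₂ _xor_ (vanishes (rotate (suc k) τ) (rotate-suc k τ zero)) (vanishes _ (rotate²-suc k τ zero)))
  where
  vanishes : ∀ σ → σ zero ≡ τ zero → b σ ≡ false
  vanishes σ σ0≡ = ≢true⇒≡false λ p →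
    true≢false (trans (sym (proj₂ (multi-supp (cons-multi (suc (suc k)) c) σ p) zero)) (trans (cong (lookup B) σ0≡) τ0∈B))

-- Decomposition.  A consistent b of order k + 2 has image form with the
-- weight w(S, y) = b(σ) for any admissible σ with image S whose last two
-- entries are (min S, y), and w(S, min S) = 0.

isLeast : ∀ {n} → Subset n → Fin n → Bool
isLeast (a ∷ᵥ S) zero    = a
isLeast (a ∷ᵥ S) (suc y) = not a ∧ isLeast S y

least-exists : ∀ {n} (S : Subset n) y → lookup S y ≡ true → ∃[ m ] isLeast S m ≡ true
least-exists (true  ∷ᵥ S) y       _ = zero , refl
least-exists (false ∷ᵥ S) (suc y) p = let (m , q) = least-exists S y p in suc m , q

least-∈ : ∀ {n} (S : Subset n) m → isLeast S m ≡ true → lookup S m ≡ true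
least-∈ (a     ∷ᵥ S) zero    p = p
least-∈ (false ∷ᵥ S) (suc m) p = least-∈ S m p

least-unique : ∀ {n} (S : Subset n) m m' → isLeast S m ≡ true → isLeast S m' ≡ true → m ≡ m'
least-unique (a     ∷ᵥ S) zero    zero     _ _ = refl
least-unique (true  ∷ᵥ S) zero    (suc m') _ ()
least-unique (true  ∷ᵥ S) (suc m) zero     () _
least-unique (false ∷ᵥ S) zero    (suc m') () _
least-unique (false ∷ᵥ S) (suc m) zero     _ ()
least-unique (false ∷ᵥ S) (suc m) (suc m') p q = cong suc (least-unique S m m' p q)

Representative : ∀ k {n} → Subset n → Subset n → Fin n → Map n (suc (suc k)) → Bool
Representative k B S y σ = (admissible B σ ∧ does (image σ ≟ₛ S)) ∧ (isLeast S (σ (penult k)) ∧ (σ (final k) == y))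

consWeight : ∀ k {n} → Subset n → Tensor n (suc (suc k)) → Weight n
consWeight k {n} B b S y = not (isLeast S y) ∧ anyMaps n (suc (suc k)) (λ σ → Representative k B S y σ ∧ b σ)

consWeight-least : ∀ k {n} (B : Subset n) b S y → isLeast S y ≡ true → consWeight k B b S y ≡ false
consWeight-least k B b S y least rewrite least = refl

consWeight-value : ∀ k {n} {B : Subset n} {b : Tensor n (suc (suc k))} → Extensional b → Invariant k B b →
                   ∀ S y σ → Admissible B σ → image σ ≡ S → isLeast S (σ (penult k)) ≡ true → σ (final k) ≡ y →
                   consWeight k B b S y ≡ b σ
consWeight-value k {n} {B} {b} ext inv S y σ adm im≡ least last≡ =
  trans (cong (_∧ anyMaps n (suc (suc k)) F) y-not-least) (bool-ext found⇒ ⇒found)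
  where
  F : Map n (suc (suc k)) → Bool
  F σ′ = Representative k B S y σ′ ∧ b σ′
  y-not-least : not (isLeast S y) ≡ true
  y-not-least with isLeast S y in eq
  ... | false = refl
  ... | true  = ⊥-elim (penult≢final k (proj₁ adm _ _ (trans (least-unique S _ _ least eq) (sym last≡))))
  found⇒ : anyMaps n (suc (suc k)) F ≡ true → b σ ≡ true
  found⇒ p =
    let (σ′ , q) = anyMaps-true n (suc (suc k)) F p
        rep = ∧-trueˡ q
        adm-im = ∧-trueˡ rep
        ends = ∧-trueʳ {admissible B σ′ ∧ does (image σ′ ≟ₛ S)} rep
        im′ = does⇒ (image σ′ ≟ₛ S) (∧-trueʳ {admissible B σ′} adm-im)
    in trans (inv σ σ′ adm (admissible⇒ B σ′ (∧-trueˡ adm-im)) (trans im≡ (sym im′))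
                  (inj₁ (least-unique S _ _ (∧-trueˡ ends) least ,
                         trans (==⇒≡ (∧-trueʳ {isLeast S (σ′ (penult k))} ends)) (sym last≡))))
             (∧-trueʳ {Representative k B S y σ′} q)
  ⇒found : b σ ≡ true → anyMaps n (suc (suc k)) F ≡ true
  ⇒found p = true-anyMaps n (suc (suc k)) F F-ext σ
    (∧-true (∧-true (∧-true (⇒admissible B σ adm) (dec-true (image σ ≟ₛ S) im≡))
                    (∧-true least (≡⇒== last≡)))
            p)
    where
    F-ext : Extensional F
    F-ext τ τ' eq =
      cong₂ _∧_ (cong₂ _∧_ (cong₂ _∧_ (admissible-cong B τ τ' eq)
                                     (cong (λ S′ → does (S′ ≟ₛ S)) (image-cong τ τ' eq)))
                           (cong₂ _∧_ (cong (isLeast S) (eq _)) (cong (_== y) (eq _))))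
                (ext τ τ' eq)

module _ (k : ℕ) {n : ℕ} {B : Subset n} {b : Tensor n (suc (suc k))}
         (ext : Extensional b) (inv : Invariant k B b) where

  private
    w = consWeight k B b

  -- min S is the penultimate entry: τ itself is a representative.
  least-at-penult : ∀ τ → Admissible B τ → isLeast (image τ) (τ (penult k)) ≡ true →
                    b τ ≡ (w (image τ) (τ (penult k)) xor w (image τ) (τ (final k)))
  least-at-penult τ adm least =
    sym (cong₂ _xor_ (consWeight-least k B b (image τ) (τ (penult k)) least)
                     (consWeight-value k {B = B} ext inv _ _ τ adm refl least refl))

  -- min S is the last entry: exchanging the last two entries gives a representative.
  least-at-final : ∀ τ → Admissible B τ → isLeast (image τ) (τ (final k)) ≡ true →
                   b τ ≡ (w (image τ) (τ (penult k)) xor w (image τ) (τ (final k)))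
  least-at-final τ adm least = begin
    b τ   ≡⟨ inv τ σ adm adm-σ (sym (image-swap (penult k) (final k) τ)) (inj₂ (σp , σf)) ⟩
    b σ   ≡⟨ sym (consWeight-value k {B = B} ext inv _ _ σ adm-σ (image-swap (penult k) (final k) τ)
                   (subst (λ z → isLeast (image τ) z ≡ true) (sym σp) least) σf) ⟩
    w (image τ) (τ (penult k))
      ≡⟨ sym (xor-identityʳ (w (image τ) (τ (penult k)))) ⟩
    w (image τ) (τ (penult k)) xor false
      ≡⟨ cong (w (image τ) (τ (penult k)) xor_) (sym (consWeight-least k B b (image τ) (τ (final k)) least)) ⟩
    w (image τ) (τ (penult k)) xor w (image τ) (τ (final k)) ∎
    where
    σ = swapAt (penult k) (final k) τ
    adm-σ = swap-admissible B _ _ τ adm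
    σp : σ (penult k) ≡ τ (final k)
    σp = cong τ (swapIx-u (penult k) (final k))
    σf : σ (final k) ≡ τ (penult k)
    σf = cong τ (swapIx-v (penult k) (final k))

-- min S is the antepenultimate entry (order ≥ 3): by the cyclic relation
-- b τ is the sum of the values at the two rotations of τ, and these are
-- (up to exchanging the last two entries) representatives for the
-- weights at τ_{k+1} and τ_{k+2}.
least-at-antepenult : ∀ k {n} {B : Subset n} {b : Tensor n (suc (suc (suc k)))} →
                      Extensional b → Invariant (suc k) B b → Cyclic k B b →
                      ∀ τ → Admissible B τ → isLeast (image τ) (τ (antepenult k)) ≡ true →
                      b τ ≡ pairWeight (suc k) (consWeight (suc k) B b) τ
least-at-antepenult k {B = B} {b} ext inv cyclic τ adm least = begin
  b τ           ≡⟨ split (b τ) (b r₁) (b r₂) (cyclic τ) ⟩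
  b r₁ xor b r₂ ≡⟨ cong (b r₁ xor_) (inv r₂ s₂ adm₂ adm-s (sym (image-swap K′ K″ r₂)) (inj₂ (s₂p , s₂f))) ⟩
  b r₁ xor b s₂ ≡⟨ sym (cong₂ _xor_ (value r₁ adm₁ im₁ r₁p r₁f) (value s₂ adm-s im-s s₂p′ s₂f′)) ⟩
  w S (τ K′) xor w S (τ K″) ∎
  where
  K′ = penult (suc k)
  K″ = final (suc k)
  S = image τ
  w = consWeight (suc k) B b
  r₁ = rotate k τ
  r₂ = rotate k r₁
  s₂ = swapAt K′ K″ r₂
  adm₁ = rotate-admissible k B τ adm
  adm₂ = rotate-admissible k B r₁ adm₁
  adm-s = swap-admissible B K′ K″ r₂ adm₂
  im₁ : image r₁ ≡ S
  im₁ = image-rotate k τ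
  im-s : image s₂ ≡ S
  im-s = trans (image-swap K′ K″ r₂) (trans (image-rotate k r₁) im₁)
  r₁p : r₁ K′ ≡ τ (antepenult k)
  r₁p = rotate-penult k τ
  r₁f : r₁ K″ ≡ τ K′
  r₁f = rotate-final k τ
  s₂p : s₂ K′ ≡ r₂ K″
  s₂p = cong r₂ (swapIx-u K′ K″)
  s₂f : s₂ K″ ≡ r₂ K′
  s₂f = cong r₂ (swapIx-v K′ K″)
  s₂p′ : s₂ K′ ≡ τ (antepenult k)
  s₂p′ = trans s₂p (trans (rotate-final k r₁) r₁p)
  s₂f′ : s₂ K″ ≡ τ K″
  s₂f′ = trans s₂f (trans (rotate-penult k r₁) (rotate-antepenult k τ))
  value : ∀ σ → Admissible B σ → image σ ≡ S → σ K′ ≡ τ (antepenult k) → ∀ {y} → σ K″ ≡ y → w S y ≡ b σ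
  value σ adm-σ im-σ σp σf =
    consWeight-value (suc k) {B = B} ext inv S _ σ adm-σ im-σ (subst (λ z → isLeast S z ≡ true) (sym σp) least) σf
  split : ∀ a b c → (a xor b xor c) ≡ false → a ≡ (b xor c)
  split true  true  true  ()
  split true  true  false _ = refl
  split true  false true  _ = refl
  split true  false false ()
  split false true  true  _ = refl
  split false true  false ()
  split false false true  ()
  split false false false _ = refl

-- min S is at any other position l before the last two: exchanging the
-- entries at l and at the antepenultimate position reduces to the
-- previous case.
least-elsewhere : ∀ k {n} {B : Subset n} {b : Tensor n (suc (suc (suc k)))} →
                  Extensional b → Invariant (suc k) B b → Cyclic k B b →
                  ∀ τ → Admissible B τ → ∀ l → isLeast (image τ) (τ l) ≡ true →
                  l ≢ penult (suc k) → l ≢ final (suc k) →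
                  b τ ≡ pairWeight (suc k) (consWeight (suc k) B b) τ
least-elsewhere k {B = B} {b} ext inv cyclic τ adm l least l≢p l≢f = begin
  b τ    ≡⟨ inv τ τ₁ adm adm₁ (sym im₁) (inj₁ (τ₁p , τ₁f)) ⟩
  b τ₁   ≡⟨ least-at-antepenult k {B = B} ext inv cyclic τ₁ adm₁ least₁ ⟩
  pairWeight (suc k) w τ₁
         ≡⟨ cong₂ _xor_ (cong₂ w im₁ τ₁p) (cong₂ w im₁ τ₁f) ⟩
  pairWeight (suc k) w τ ∎
  where
  w = consWeight (suc k) B b
  τ₁ = swapAt l (antepenult k) τ
  adm₁ = swap-admissible B l (antepenult k) τ adm
  im₁ : image τ₁ ≡ image τ
  im₁ = image-swap l (antepenult k) τ
  least₁ : isLeast (image τ₁) (τ₁ (antepenult k)) ≡ true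
  least₁ = subst₂ (λ S z → isLeast S z ≡ true) (sym im₁) (sym (cong τ (swapIx-v l (antepenult k)))) least
  τ₁p : τ₁ (penult (suc k)) ≡ τ (penult (suc k))
  τ₁p = cong τ (swapIx-other l (antepenult k) _ (l≢p ∘ sym) (antepenult≢penult k ∘ sym))
  τ₁f : τ₁ (final (suc k)) ≡ τ (final (suc k))
  τ₁f = cong τ (swapIx-other l (antepenult k) _ (l≢f ∘ sym) (antepenult≢final k ∘ sym))

-- For k = 0 every position is one of the last two; otherwise the cyclic
-- relation handles the remaining positions.
least-not-last : ∀ k {n} {B : Subset n} {b : Tensor n (suc (suc k))} → Cons (suc (suc k)) B b →
                 ∀ τ → Admissible B τ → ∀ l → isLeast (image τ) (τ l) ≡ true → l ≢ penult k → l ≢ final k →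
                 b τ ≡ pairWeight k (consWeight k B b) τ
least-not-last zero    c τ adm zero       _     l≢p _   = ⊥-elim (l≢p refl)
least-not-last zero    c τ adm (suc zero) _     _   l≢f = ⊥-elim (l≢f refl)
least-not-last (suc k) {B = B} c τ adm l least l≢p l≢f =
  least-elsewhere k {B = B} (cons-ext (suc k) c) (cons-invariant (suc k) c) (cons-cyclic k c) τ adm l least l≢p l≢f

cons⇒imageForm : ∀ k {n} {B : Subset n} {b : Tensor n (suc (suc k))} → Cons (suc (suc k)) B b → ImageForm k B b
cons⇒imageForm k {B = B} {b} c = withWeight (consWeight k B b) formula
  where
  ext = cons-ext k c
  inv = cons-invariant k c
  decompose : ∀ τ → Admissible B τ → b τ ≡ pairWeight k (consWeight k B b) τ
  decompose τ adm = by-position (l F.≟ penult k) (l F.≟ final k)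
    where
    S = image τ
    m = proj₁ (least-exists S (τ (penult k)) (true-image τ (penult k)))
    m-least = proj₂ (least-exists S (τ (penult k)) (true-image τ (penult k)))
    l = proj₁ (image-true τ m (least-∈ S m m-least))
    least : ∀ l′ → l′ ≡ l → isLeast S (τ l′) ≡ true
    least l′ refl = subst (λ z → isLeast S z ≡ true) (sym (proj₂ (image-true τ m (least-∈ S m m-least)))) m-least
    by-position : Dec (l ≡ penult k) → Dec (l ≡ final k) → b τ ≡ pairWeight k (consWeight k B b) τ
    by-position (yes l≡p) _         = least-at-penult k {B = B} ext inv τ adm (least _ (sym l≡p))
    by-position (no _)    (yes l≡f) = least-at-final k {B = B} ext inv τ adm (least _ (sym l≡f))
    by-position (no l≢p)  (no l≢f)  = least-not-last k c τ adm l (least l refl) l≢p l≢f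
  formula : ImageFormWith k B (consWeight k B b) b
  formula τ with admissible B τ in adm
  ... | false = ≢true⇒≡false λ p → true≢false (trans (sym (⇒admissible B τ (multi-supp (cons-multi k c) τ p))) adm)
  ... | true  = decompose τ (admissible⇒ B τ adm)

proposition2p4 : (n i : ℕ) → 1 ≤ i → (B : Subset n) → (b : Tensor n i) →
                   (Cons i B b → Gov i B b) × (Gov i B b → Cons i B b)
-- In order 1, Cons and Gov coincide by definition; in order k + 2 both
-- coincide with the tensors of image form over B.
proposition2p4 n zero          () B b
proposition2p4 n (suc zero)    _  B b = id , id
proposition2p4 n (suc (suc k)) _  B b =
  imageForm⇒gov k ∘ cons⇒imageForm k ,
  imageForm⇒cons k ∘ gov⇒imageForm k
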